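{- Let $\mathcal C_n$ be the set of permutations in $\mathfrak S_n$ avoiding the generalized patterns $2\text{ - }1\text{ - }3$ and $34\text{ - }21$, and let $K(t,u,v)=\sum_{n\ge1}\sum_{\pi\in\mathcal C_n}u^{s(\pi)}v^{\pi_n}t^n$. Then $$K(t,u,v)=\frac{tv\left[1-(1+u+uv)t+(u^2+uv+u^2v)t^2\right]}{(1-t-tu)(1-t-tuv)(1-tuv)}.$$
   Context: $\mathfrak S_n$ is the set of permutations $\pi=\pi_1\cdots\pi_n$ of $\{1,\dots,n\}$. $\pi$ avoids $2\text{ - }1\text{ - }3$ if there are no $i<j<k$ with $\pi_j<\pi_i<\pi_k$; $\pi$ avoids $34\text{ - }21$ if there are no $i$ and $k>i+1$ with $\pi_{k+1}<\pi_k<\pi_i<\pi_{i+1}$. For $\pi\in\mathfrak S_n$, $s(\pi)=0$ if $\pi=n(n-1)\cdots21$, and otherwise $s(\pi)=\max\{\pi_i:\pi_i<\pi_{i+1}\}$. -}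

module Defs where

open import Data.Nat as ℕ using (ℕ; zero; suc; _∸_)
open import Data.Integer as ℤ using (ℤ; +_; -_)
open import Data.Fin using (Fin; toℕ)
open import Data.Vec using (Vec; lookup; tabulate; last)
open import Data.List using (List; length)
open import Data.List.Relation.Unary.Unique.Propositional using (Unique)
open import Data.List.Membership.Propositional using (_∈_)
open import Data.Product using (Σ; _×_; ∃-syntax)
open import Data.Sum using (_⊎_)
open import Relation.Nullary using (¬_)
open import Relation.Binary.PropositionalEquality using (_≡_; _≢_)

-- Permutations of {1,…,n} in one-line notation: π = π₁ ⋯ πₙ is a vector
-- of naturals; position i (0-based Fin index) holds π_{i+1}.

IsPerm : (n : ℕ) → Vec ℕ n → Set
IsPerm n π =
  (∀ i → 1 ℕ.≤ lookup π i × lookup π i ℕ.≤ n) ×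
  (∀ i j → lookup π i ≡ lookup π j → i ≡ j)

Avoids2-1-3 : {n : ℕ} → Vec ℕ n → Set
Avoids2-1-3 {n} π =
  ∀ (i j k : Fin n) → toℕ i ℕ.< toℕ j → toℕ j ℕ.< toℕ k →
  ¬ (lookup π j ℕ.< lookup π i × lookup π i ℕ.< lookup π k)

Avoids34-21 : {n : ℕ} → Vec ℕ n → Set
Avoids34-21 {n} π =
  ∀ (i i' k k' : Fin n) → toℕ i' ≡ suc (toℕ i) → toℕ k' ≡ suc (toℕ k) →
  suc (toℕ i) ℕ.< toℕ k →
  ¬ (lookup π k' ℕ.< lookup π k × lookup π k ℕ.< lookup π i × lookup π i ℕ.< lookup π i')

InC : (n : ℕ) → Vec ℕ n → Set
InC n π = IsPerm n π × Avoids2-1-3 π × Avoids34-21 π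

decreasing : (n : ℕ) → Vec ℕ n
decreasing n = tabulate (λ i → n ∸ toℕ i)

AscentAt : {n : ℕ} → Vec ℕ n → Fin n → Set
AscentAt {n} π i = Σ (Fin n) λ i' → toℕ i' ≡ suc (toℕ i) × lookup π i ℕ.< lookup π i'

HasS : {n : ℕ} → Vec ℕ n → ℕ → Set
HasS {n} π a =
  (π ≡ decreasing n × a ≡ 0) ⊎
  (π ≢ decreasing n ×
     (Σ (Fin n) λ i → AscentAt π i × lookup π i ≡ a) ×
     (∀ i → AscentAt π i → lookup π i ℕ.≤ a))

HasCard : {A : Set} → (A → Set) → ℕ → Set
HasCard {A} P k =
  Σ (List A) λ L → Unique L × (∀ x → (x ∈ L → P x) × (P x → x ∈ L)) × length L ≡ k

-- Formal power series in t, u, v with integer coefficients: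
-- f n a b is the coefficient of t^n u^a v^b.

Series : Set
Series = ℕ → ℕ → ℕ → ℤ

sumTo : ℕ → (ℕ → ℤ) → ℤ
sumTo zero    f = f 0
sumTo (suc n) f = sumTo n f ℤ.+ f (suc n)

_⊕_ : Series → Series → Series
(f ⊕ g) n a b = f n a b ℤ.+ g n a b

_⊗_ : Series → Series → Series
(f ⊗ g) n a b =
  sumTo n λ i → sumTo a λ j → sumTo b λ k →
    f i j k ℤ.* g (n ∸ i) (a ∸ j) (b ∸ k)

infixl 6 _⊕_
infixl 7 _⊗_

mono : ℤ → ℕ → ℕ → ℕ → Series
mono c i j k n a b with n ℕ.≟ i | a ℕ.≟ j | b ℕ.≟ k
... | Relation.Nullary.yes _ | Relation.Nullary.yes _ | Relation.Nullary.yes _ = c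
... | _ | _ | _ = + 0

denominator : Series
denominator =
  (mono (+ 1) 0 0 0 ⊕ mono (- + 1) 1 0 0 ⊕ mono (- + 1) 1 1 0) ⊗
  (mono (+ 1) 0 0 0 ⊕ mono (- + 1) 1 0 0 ⊕ mono (- + 1) 1 1 1) ⊗
  (mono (+ 1) 0 0 0 ⊕ mono (- + 1) 1 1 1)

numerator : Series
numerator =
  mono (+ 1) 1 0 1 ⊗
  (mono (+ 1) 0 0 0 ⊕
   mono (- + 1) 1 0 0 ⊕ mono (- + 1) 1 1 0 ⊕ mono (- + 1) 1 1 1 ⊕
   mono (+ 1) 2 2 0 ⊕ mono (+ 1) 2 1 1 ⊕ mono (+ 1) 2 2 1)

IsK : Series → Set
IsK c =
  (∀ a b → c 0 a b ≡ + 0) ×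
  (∀ m a b → Σ ℕ λ k → c (suc m) a b ≡ + k ×
     HasCard (λ (π : Vec ℕ (suc m)) → InC (suc m) π × HasS π a × last π ≡ b) k)

module Submission where

-- Every permutation of length m+2 is σ ◂ b:
-- the value b appended to a permutation σ of length m+1 whose values ≥ b are bumped up. For
-- σ ∈ 𝒞 with last value c and statistic s, σ ◂ b ∈ 𝒞 iff 1 ≤ b ≤ c+1 and (b ≤ c ⇒ s < c), and
-- then s(σ ◂ b) is determined by s, c and b. The last value of a member of 𝒞 is s+1 or lies
-- in 1 … s-1, and this yields duplicate-free lists of the classes {π ∈ 𝒞 : s(π) = a, last π = b}
-- together with a recursion for their sizes count m a b.
--
-- Multiplying a series by a
-- polynomial is a finite combination of shifts (p ◃ f), so no general associativity of the
-- Cauchy product is needed. Splitting K = X + Y into the diagonal part (b = a+1) and the part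
-- below it, the recursion gives (1-t-tuv) X = tv, (1-tuv) Y = W, (1-t-tuv) W = V and
-- (1-t-tu) V = t³u²v (Pascal's rule for the diagonal counts); the theorem follows by
-- commuting the factors of the denominator.

open import Defs

module PowerSeries where

  open import Data.Nat as ℕ using (ℕ; zero; suc; _∸_; z≤n; s≤s)
  import Data.Nat.Properties as ℕP
  open import Data.Integer using (ℤ; +_; _+_; _*_)
  import Data.Integer.Properties as ℤP
  open import Data.Integer.Tactic.RingSolver using (solve-∀)
  open import Data.List using (List; []; _∷_; _++_; map; foldl)
  open import Data.Product using (_×_; _,_)
  open import Data.Sum using (inj₁; inj₂)
  open import Relation.Nullary using (yes; no)
  open import Relation.Binary using (Setoid)
  open import Relation.Binary.PropositionalEquality
  open import Data.Empty using (⊥-elim)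

  infix 4 _≐_
  _≐_ : Series → Series → Set
  f ≐ g = ∀ n a b → f n a b ≡ g n a b

  ≐-setoid : Setoid _ _
  ≐-setoid = record
    { Carrier = Series ; _≈_ = _≐_
    ; isEquivalence = record
      { refl  = λ _ _ _ → refl
      ; sym   = λ e n a b → sym (e n a b)
      ; trans = λ e e′ n a b → trans (e n a b) (e′ n a b) } }

  ≐-sym : ∀ {f g} → f ≐ g → g ≐ f
  ≐-sym = Setoid.sym ≐-setoid

  sumTo-cong : ∀ n {f g : ℕ → ℤ} → (∀ x → x ℕ.≤ n → f x ≡ g x) → sumTo n f ≡ sumTo n g
  sumTo-cong zero    e = e 0 z≤n
  sumTo-cong (suc n) e = cong₂ _+_ (sumTo-cong n (λ x x≤n → e x (ℕP.m≤n⇒m≤1+n x≤n))) (e (suc n) ℕP.≤-refl)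

  sumTo-+ : ∀ n (f g : ℕ → ℤ) → sumTo n (λ x → f x + g x) ≡ sumTo n f + sumTo n g
  sumTo-+ zero    f g = refl
  sumTo-+ (suc n) f g rewrite sumTo-+ n f g = exchange (sumTo n f) (sumTo n g) (f (suc n)) (g (suc n))
    where exchange : ∀ a b c d → (a + b) + (c + d) ≡ (a + c) + (b + d)
          exchange = solve-∀

  sumTo-scale : ∀ n e (f : ℕ → ℤ) → sumTo n (λ x → e * f x) ≡ e * sumTo n f
  sumTo-scale zero    e f = refl
  sumTo-scale (suc n) e f rewrite sumTo-scale n e f = sym (ℤP.*-distribˡ-+ e (sumTo n f) (f (suc n)))

  sumTo-zero : ∀ n → sumTo n (λ _ → + 0) ≡ + 0
  sumTo-zero zero    = refl
  sumTo-zero (suc n) rewrite sumTo-zero n = refl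

  ind : ℕ → ℕ → ℤ
  ind zero    zero    = + 1
  ind zero    (suc _) = + 0
  ind (suc _) zero    = + 0
  ind (suc i) (suc n) = ind i n

  ind-≡ : ∀ {i n} → i ≡ n → ind i n ≡ + 1
  ind-≡ {zero}  refl = refl
  ind-≡ {suc i} refl = ind-≡ {i} refl

  ind-≢ : ∀ i n → i ≢ n → ind i n ≡ + 0
  ind-≢ zero    zero    ne = ⊥-elim (ne refl)
  ind-≢ zero    (suc n) ne = refl
  ind-≢ (suc i) zero    ne = refl
  ind-≢ (suc i) (suc n) ne = ind-≢ i n (λ e → ne (cong suc e))

  -- The one-variable shift: shift₁ i n g = g (n - i) if i ≤ n, else 0
  -- (the coefficients of x^i · g(x)).
  shift₁ : ℕ → ℕ → (ℕ → ℤ) → ℤ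
  shift₁ zero    n       g = g n
  shift₁ (suc i) zero    g = + 0
  shift₁ (suc i) (suc n) g = shift₁ i n g

  shift₁-in : ∀ i n g → i ℕ.≤ n → shift₁ i n g ≡ g (n ∸ i)
  shift₁-in zero    n       g _         = refl
  shift₁-in (suc i) (suc n) g (s≤s i≤n) = shift₁-in i n g i≤n

  shift₁-out : ∀ i n g → n ℕ.< i → shift₁ i n g ≡ + 0
  shift₁-out (suc i) zero    g _         = refl
  shift₁-out (suc i) (suc n) g (s≤s n<i) = shift₁-out i n g n<i

  shift₁-cong : ∀ i n {f g : ℕ → ℤ} → (∀ x → f x ≡ g x) → shift₁ i n f ≡ shift₁ i n g
  shift₁-cong zero    n       e = e n
  shift₁-cong (suc i) zero    e = refl
  shift₁-cong (suc i) (suc n) e = shift₁-cong i n e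

  shift₁-map : ∀ i n (h : ℤ → ℤ) → h (+ 0) ≡ + 0 → ∀ g → shift₁ i n (λ x → h (g x)) ≡ h (shift₁ i n g)
  shift₁-map zero    n       h h0 g = refl
  shift₁-map (suc i) zero    h h0 g = sym h0
  shift₁-map (suc i) (suc n) h h0 g = shift₁-map i n h h0 g

  shift₁-zip : ∀ i n (h : ℤ → ℤ → ℤ) → h (+ 0) (+ 0) ≡ + 0 → ∀ f g →
               shift₁ i n (λ x → h (f x) (g x)) ≡ h (shift₁ i n f) (shift₁ i n g)
  shift₁-zip zero    n       h h0 f g = refl
  shift₁-zip (suc i) zero    h h0 f g = sym h0
  shift₁-zip (suc i) (suc n) h h0 f g = shift₁-zip i n h h0 f g

  shift₁-swap : ∀ i n j m (F : ℕ → ℕ → ℤ) →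
                shift₁ i n (λ x → shift₁ j m (F x)) ≡ shift₁ j m (λ y → shift₁ i n (λ x → F x y))
  shift₁-swap zero    n       j m F = refl
  shift₁-swap (suc i) zero    j m F = sym (shift₁-map j m (λ _ → + 0) refl (λ _ → + 0))
  shift₁-swap (suc i) (suc n) j m F = shift₁-swap i n j m F

  shift₁-shift₁ : ∀ i n j g → shift₁ i n (λ x → shift₁ j x g) ≡ shift₁ (i ℕ.+ j) n g
  shift₁-shift₁ zero    n       j g = refl
  shift₁-shift₁ (suc i) zero    j g = refl
  shift₁-shift₁ (suc i) (suc n) j g = shift₁-shift₁ i n j g

  shift₁-ind : ∀ i n j → shift₁ i n (ind j) ≡ ind (i ℕ.+ j) n
  shift₁-ind zero    n       j = refl
  shift₁-ind (suc i) zero    j = refl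
  shift₁-ind (suc i) (suc n) j = shift₁-ind i n j

  sum-ind : ∀ n p (g : ℕ → ℤ) → p ℕ.≤ n → sumTo n (λ x → ind p x * g x) ≡ g p
  sum-ind-out : ∀ n p (g : ℕ → ℤ) → n ℕ.< p → sumTo n (λ x → ind p x * g x) ≡ + 0
  sum-ind-out zero    (suc p) g _ = refl
  sum-ind-out (suc n) p       g n<p
    rewrite sum-ind-out n p g (ℕP.<-trans (ℕP.n<1+n n) n<p)
          | ind-≢ p (suc n) (λ e → ℕP.<-irrefl (sym e) n<p) = refl
  sum-ind zero    zero g z≤n = ℤP.*-identityˡ (g 0)
  sum-ind (suc n) p    g p≤n with ℕP.m≤n⇒m<n∨m≡n p≤n
  ... | inj₁ p<n rewrite sum-ind n p g (ℕP.≤-pred p<n)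
                       | ind-≢ p (suc n) (λ e → ℕP.<-irrefl e p<n) = ℤP.+-identityʳ (g p)
  ... | inj₂ refl rewrite sum-ind-out n (suc n) g (ℕP.n<1+n n)
                        | ind-≡ {n} refl = trans (ℤP.+-identityˡ _) (ℤP.*-identityˡ (g (suc n)))

  convolve-ind : ∀ n i (g : ℕ → ℤ) → sumTo n (λ x → ind i (n ∸ x) * g x) ≡ shift₁ i n g
  convolve-ind n i g with i ℕ.≤? n
  ... | yes i≤n = begin
    sumTo n (λ x → ind i (n ∸ x) * g x)  ≡⟨ sumTo-cong n (λ x x≤n → cong (_* g x) (reflect x x≤n)) ⟩
    sumTo n (λ x → ind (n ∸ i) x * g x)  ≡⟨ sum-ind n (n ∸ i) g (ℕP.m∸n≤m n i) ⟩
    g (n ∸ i)                            ≡⟨ sym (shift₁-in i n g i≤n) ⟩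
    shift₁ i n g                         ∎
    where
    open ≡-Reasoning
    reflect : ∀ x → x ℕ.≤ n → ind i (n ∸ x) ≡ ind (n ∸ i) x
    reflect x x≤n with x ℕ.≟ n ∸ i
    ... | yes refl rewrite ℕP.m∸[m∸n]≡n i≤n = trans (ind-≡ {i} refl) (sym (ind-≡ {n ∸ i} refl))
    ... | no x≢ = trans (ind-≢ i (n ∸ x) (λ e → x≢ (trans (sym (ℕP.m∸[m∸n]≡n x≤n)) (cong (n ∸_) (sym e)))))
                        (sym (ind-≢ (n ∸ i) x (λ e → x≢ (sym e))))
  ... | no i≰n = begin
    sumTo n (λ x → ind i (n ∸ x) * g x)
      ≡⟨ sumTo-cong n (λ x _ → cong (_* g x) (ind-≢ i (n ∸ x) (λ e → i≰n (subst (ℕ._≤ n) (sym e) (ℕP.m∸n≤m n x))))) ⟩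
    sumTo n (λ x → + 0 * g x)  ≡⟨ sumTo-zero n ⟩
    + 0                        ≡⟨ sym (shift₁-out i n g (ℕP.≰⇒> i≰n)) ⟩
    shift₁ i n g               ∎
    where open ≡-Reasoning

  mono-ind : ∀ c i j k n a b → mono c i j k n a b ≡ c * (ind i n * (ind j a * ind k b))
  mono-ind c i j k n a b with n ℕ.≟ i | a ℕ.≟ j | b ℕ.≟ k
  ... | yes p | yes q | yes r rewrite ind-≡ (sym p) | ind-≡ (sym q) | ind-≡ (sym r) = sym (ℤP.*-identityʳ c)
  ... | no p  | _     | _     rewrite ind-≢ i n (λ e → p (sym e)) = sym (ℤP.*-zeroʳ c)
  ... | yes _ | no q  | _     rewrite ind-≢ j a (λ e → q (sym e)) | ℤP.*-zeroʳ (ind i n) = sym (ℤP.*-zeroʳ c)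
  ... | yes _ | yes _ | no r  rewrite ind-≢ k b (λ e → r (sym e)) | ℤP.*-zeroʳ (ind j a)
                                    | ℤP.*-zeroʳ (ind i n) = sym (ℤP.*-zeroʳ c)

  -- Multiplication by the monomial tⁱuʲvᵏ.
  shift : ℕ → ℕ → ℕ → Series → Series
  shift i j k f n a b = shift₁ i n λ x → shift₁ j a λ y → shift₁ k b λ z → f x y z

  shift-cong : ∀ i j k {f g} → f ≐ g → shift i j k f ≐ shift i j k g
  shift-cong i j k e n a b = shift₁-cong i n λ x → shift₁-cong j a λ y → shift₁-cong k b λ z → e x y z

  shift-map : ∀ i j k (h : ℤ → ℤ) → h (+ 0) ≡ + 0 → ∀ f n a b →
              shift i j k (λ x y z → h (f x y z)) n a b ≡ h (shift i j k f n a b)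
  shift-map i j k h h0 f n a b =
    trans (shift₁-cong i n λ x → trans (shift₁-cong j a λ y → shift₁-map k b h h0 _) (shift₁-map j a h h0 _))
          (shift₁-map i n h h0 _)

  shift-zip : ∀ i j k (h : ℤ → ℤ → ℤ) → h (+ 0) (+ 0) ≡ + 0 → ∀ f g n a b →
              shift i j k (λ x y z → h (f x y z) (g x y z)) n a b ≡ h (shift i j k f n a b) (shift i j k g n a b)
  shift-zip i j k h h0 f g n a b =
    trans (shift₁-cong i n λ x → trans (shift₁-cong j a λ y → shift₁-zip k b h h0 _ _) (shift₁-zip j a h h0 _ _))
          (shift₁-zip i n h h0 _ _)

  shift-shift : ∀ i j k i′ j′ k′ f → shift i j k (shift i′ j′ k′ f) ≐ shift (i ℕ.+ i′) (j ℕ.+ j′) (k ℕ.+ k′) f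
  shift-shift i j k i′ j′ k′ f n a b = begin
    shift₁ i n (λ x → shift₁ j a λ y → shift₁ k b λ z → shift₁ i′ x λ x′ → shift₁ j′ y λ y′ → shift₁ k′ z λ z′ → f x′ y′ z′)
      ≡⟨ shift₁-cong i n (λ x → trans (shift₁-cong j a λ y → shift₁-swap k b i′ x _) (shift₁-swap j a i′ x _)) ⟩
    shift₁ i n (λ x → shift₁ i′ x λ x′ → shift₁ j a λ y → shift₁ k b λ z → shift₁ j′ y λ y′ → shift₁ k′ z λ z′ → f x′ y′ z′)
      ≡⟨ shift₁-shift₁ i n i′ _ ⟩
    shift₁ (i ℕ.+ i′) n (λ x′ → shift₁ j a λ y → shift₁ k b λ z → shift₁ j′ y λ y′ → shift₁ k′ z λ z′ → f x′ y′ z′)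
      ≡⟨ shift₁-cong (i ℕ.+ i′) n (λ x′ → trans (shift₁-cong j a λ y → shift₁-swap k b j′ y _) (shift₁-shift₁ j a j′ _)) ⟩
    shift₁ (i ℕ.+ i′) n (λ x′ → shift₁ (j ℕ.+ j′) a λ y′ → shift₁ k b λ z → shift₁ k′ z λ z′ → f x′ y′ z′)
      ≡⟨ shift₁-cong (i ℕ.+ i′) n (λ x′ → shift₁-cong (j ℕ.+ j′) a λ y′ → shift₁-shift₁ k b k′ _) ⟩
    shift (i ℕ.+ i′) (j ℕ.+ j′) (k ℕ.+ k′) f n a b ∎
    where open ≡-Reasoning

  shift-mono : ∀ i j k c i′ j′ k′ → shift i j k (mono c i′ j′ k′) ≐ mono c (i ℕ.+ i′) (j ℕ.+ j′) (k ℕ.+ k′)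
  shift-mono i j k c i′ j′ k′ n a b = begin
    shift i j k (mono c i′ j′ k′) n a b
      ≡⟨ shift-cong i j k (λ x y z → trans (mono-ind c i′ j′ k′ x y z) (regroup c (ind i′ x) (ind j′ y) (ind k′ z))) n a b ⟩
    shift₁ i n (λ x → shift₁ j a λ y → shift₁ k b λ z → (c * ind i′ x) * (ind j′ y * ind k′ z))
      ≡⟨ shift₁-cong i n (λ x → shift₁-cong j a λ y → shift₁-map k b (λ w → (c * ind i′ x) * (ind j′ y * w))
           (trans (cong ((c * ind i′ x) *_) (ℤP.*-zeroʳ (ind j′ y))) (ℤP.*-zeroʳ (c * ind i′ x))) (ind k′)) ⟩
    shift₁ i n (λ x → shift₁ j a λ y → (c * ind i′ x) * (ind j′ y * shift₁ k b (ind k′)))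
      ≡⟨ shift₁-cong i n (λ x → shift₁-map j a (λ w → (c * ind i′ x) * (w * shift₁ k b (ind k′)))
           (trans (cong ((c * ind i′ x) *_) (ℤP.*-zeroˡ (shift₁ k b (ind k′)))) (ℤP.*-zeroʳ (c * ind i′ x))) (ind j′)) ⟩
    shift₁ i n (λ x → (c * ind i′ x) * (shift₁ j a (ind j′) * shift₁ k b (ind k′)))
      ≡⟨ shift₁-map i n (λ w → (c * w) * (shift₁ j a (ind j′) * shift₁ k b (ind k′)))
           (trans (cong (_* (shift₁ j a (ind j′) * shift₁ k b (ind k′))) (ℤP.*-zeroʳ c))
                  (ℤP.*-zeroˡ (shift₁ j a (ind j′) * shift₁ k b (ind k′)))) (ind i′) ⟩
    (c * shift₁ i n (ind i′)) * (shift₁ j a (ind j′) * shift₁ k b (ind k′))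
      ≡⟨ cong₂ (λ p q → (c * p) * q) (shift₁-ind i n i′) (cong₂ _*_ (shift₁-ind j a j′) (shift₁-ind k b k′)) ⟩
    (c * ind (i ℕ.+ i′) n) * (ind (j ℕ.+ j′) a * ind (k ℕ.+ k′) b)
      ≡⟨ sym (trans (mono-ind c _ _ _ n a b) (regroup c (ind (i ℕ.+ i′) n) (ind (j ℕ.+ j′) a) (ind (k ℕ.+ k′) b))) ⟩
    mono c (i ℕ.+ i′) (j ℕ.+ j′) (k ℕ.+ k′) n a b ∎
    where
    open ≡-Reasoning
    regroup : ∀ c x y z → c * (x * (y * z)) ≡ (c * x) * (y * z)
    regroup c x y z = sym (ℤP.*-assoc c x (y * z))

  ⊗-congʳ : ∀ f {g h} → g ≐ h → f ⊗ g ≐ f ⊗ h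
  ⊗-congʳ f e n a b = sumTo-cong n λ i _ → sumTo-cong a λ j _ → sumTo-cong b λ k _ →
    cong (f i j k *_) (e (n ∸ i) (a ∸ j) (b ∸ k))

  ⊗-congˡ : ∀ {f g} h → f ≐ g → f ⊗ h ≐ g ⊗ h
  ⊗-congˡ h e n a b = sumTo-cong n λ i _ → sumTo-cong a λ j _ → sumTo-cong b λ k _ →
    cong (_* h (n ∸ i) (a ∸ j) (b ∸ k)) (e i j k)

  ⊗-distribʳ : ∀ f g h → f ⊗ (g ⊕ h) ≐ f ⊗ g ⊕ f ⊗ h
  ⊗-distribʳ f g h n a b =
    trans (sumTo-cong n λ i _ → trans (sumTo-cong a λ j _ →
             trans (sumTo-cong b λ k _ → ℤP.*-distribˡ-+ (f i j k) _ _) (sumTo-+ b _ _)) (sumTo-+ a _ _))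
          (sumTo-+ n _ _)

  zeroSeries : Series
  zeroSeries _ _ _ = + 0

  ⊗-zeroʳ : ∀ f → f ⊗ zeroSeries ≐ zeroSeries
  ⊗-zeroʳ f n a b =
    trans (sumTo-cong n λ i _ → trans (sumTo-cong a λ j _ →
             trans (sumTo-cong b λ k _ → ℤP.*-zeroʳ (f i j k)) (sumTo-zero b)) (sumTo-zero a))
          (sumTo-zero n)

  ⊗-mono : ∀ f c i j k n a b → (f ⊗ mono c i j k) n a b ≡ c * shift i j k f n a b
  ⊗-mono f c i j k n a b = begin
    (f ⊗ mono c i j k) n a b
      ≡⟨ sumTo-cong n (λ x _ → sumTo-cong a λ y _ → sumTo-cong b λ z _ →
           trans (cong (f x y z *_) (mono-ind c i j k (n ∸ x) (a ∸ y) (b ∸ z)))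
                 (regroup (f x y z) c (ind i (n ∸ x)) (ind j (a ∸ y)) (ind k (b ∸ z)))) ⟩
    sumTo n (λ x → sumTo a λ y → sumTo b λ z → ind i (n ∸ x) * (ind j (a ∸ y) * (ind k (b ∸ z) * (c * f x y z))))
      ≡⟨ sumTo-cong n (λ x _ → trans (sumTo-cong a (λ y _ →
            trans (sumTo-scale b (ind i (n ∸ x)) _) (cong (ind i (n ∸ x) *_) (sumTo-scale b (ind j (a ∸ y)) _))))
            (sumTo-scale a (ind i (n ∸ x)) _)) ⟩
    sumTo n (λ x → ind i (n ∸ x) * sumTo a λ y → ind j (a ∸ y) * sumTo b λ z → ind k (b ∸ z) * (c * f x y z))
      ≡⟨ trans (convolve-ind n i _) (shift₁-cong i n λ x → trans (convolve-ind a j _) (shift₁-cong j a λ y → convolve-ind b k _)) ⟩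
    shift i j k (λ x y z → c * f x y z) n a b
      ≡⟨ shift-map i j k (c *_) (ℤP.*-zeroʳ c) f n a b ⟩
    c * shift i j k f n a b ∎
    where
    open ≡-Reasoning
    regroup : ∀ F c I J L → F * (c * (I * (J * L))) ≡ I * (J * (L * (c * F)))
    regroup = solve-∀

  -- Polynomials in t, u, v as lists of terms c tⁱuʲvᵏ, written (c , i , j , k).
  Term : Set
  Term = ℤ × ℕ × ℕ × ℕ

  Poly : Set
  Poly = List Term

  monomial : Term → Series
  monomial (c , i , j , k) = mono c i j k

  -- The series of a polynomial, as the left-nested sum of monomials used in Defs.
  ⟦_⟧ : Poly → Series
  ⟦ [] ⟧    = zeroSeries
  ⟦ t ∷ p ⟧ = foldl (λ acc s → acc ⊕ monomial s) (monomial t) p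

  sumOver : Poly → (Term → ℤ) → ℤ
  sumOver []      h = + 0
  sumOver (t ∷ p) h = h t + sumOver p h

  sumOver-cong : ∀ p {g h : Term → ℤ} → (∀ t → g t ≡ h t) → sumOver p g ≡ sumOver p h
  sumOver-cong []      e = refl
  sumOver-cong (t ∷ p) e = cong₂ _+_ (e t) (sumOver-cong p e)

  sumOver-++ : ∀ p q h → sumOver (p ++ q) h ≡ sumOver p h + sumOver q h
  sumOver-++ []      q h = sym (ℤP.+-identityˡ _)
  sumOver-++ (t ∷ p) q h rewrite sumOver-++ p q h = sym (ℤP.+-assoc (h t) (sumOver p h) (sumOver q h))

  sumOver-map : ∀ (g : Term → Term) p h → sumOver (map g p) h ≡ sumOver p (λ t → h (g t))
  sumOver-map g []      h = refl
  sumOver-map g (t ∷ p) h = cong (λ x → h (g t) + x) (sumOver-map g p h)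

  sumOver-scale : ∀ p e h → e * sumOver p h ≡ sumOver p (λ t → e * h t)
  sumOver-scale []      e h = ℤP.*-zeroʳ e
  sumOver-scale (t ∷ p) e h = trans (ℤP.*-distribˡ-+ e (h t) (sumOver p h)) (cong (λ x → e * h t + x) (sumOver-scale p e h))

  sumOver-+ : ∀ p g h → sumOver p (λ t → g t + h t) ≡ sumOver p g + sumOver p h
  sumOver-+ []      g h = refl
  sumOver-+ (t ∷ p) g h rewrite sumOver-+ p g h = exchange (g t) (h t) (sumOver p g) (sumOver p h)
    where exchange : ∀ a b c d → (a + b) + (c + d) ≡ (a + c) + (b + d)
          exchange = solve-∀

  sumOver-swap : ∀ p q (h : Term → Term → ℤ) →
                 sumOver p (λ t → sumOver q (h t)) ≡ sumOver q (λ r → sumOver p (λ t → h t r))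
  sumOver-swap []      q h = sym (sumOver-zero q)
    where sumOver-zero : ∀ q → sumOver q (λ _ → + 0) ≡ + 0
          sumOver-zero []      = refl
          sumOver-zero (_ ∷ q) = trans (ℤP.+-identityˡ _) (sumOver-zero q)
  sumOver-swap (t ∷ p) q h = trans (cong (λ x → sumOver q (h t) + x) (sumOver-swap p q h)) (sym (sumOver-+ q (h t) _))

  ⟦⟧-coeff : ∀ p n a b → ⟦ p ⟧ n a b ≡ sumOver p (λ t → monomial t n a b)
  ⟦⟧-coeff []      n a b = refl
  ⟦⟧-coeff (t ∷ p) n a b = accumulate (monomial t) p
    where
    accumulate : ∀ acc p → foldl (λ acc s → acc ⊕ monomial s) acc p n a b ≡ acc n a b + sumOver p (λ t → monomial t n a b)
    accumulate acc []      = sym (ℤP.+-identityʳ _)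
    accumulate acc (s ∷ p) = trans (accumulate (acc ⊕ monomial s) p) (ℤP.+-assoc (acc n a b) _ _)

  act : Term → Series → Series
  act (c , i , j , k) f n a b = c * shift i j k f n a b

  infixr 6.5 _◃_
  _◃_ : Poly → Series → Series
  (p ◃ f) n a b = sumOver p (λ t → act t f n a b)

  _⋆_ : Term → Term → Term
  (c , i , j , k) ⋆ (c′ , i′ , j′ , k′) = (c * c′ , i ℕ.+ i′ , j ℕ.+ j′ , k ℕ.+ k′)

  infixl 7 _·ₚ_
  _·ₚ_ : Poly → Poly → Poly
  p ·ₚ []      = []
  p ·ₚ (r ∷ q) = map (r ⋆_) p ++ p ·ₚ q

  ◃-cong : ∀ p {f g} → f ≐ g → p ◃ f ≐ p ◃ g
  ◃-cong p e n a b = sumOver-cong p λ { (c , i , j , k) → cong (c *_) (shift-cong i j k e n a b) }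

  ◃-⊕ : ∀ p f g → p ◃ (f ⊕ g) ≐ p ◃ f ⊕ p ◃ g
  ◃-⊕ p f g n a b =
    trans (sumOver-cong p λ { (c , i , j , k) →
             trans (cong (c *_) (shift-zip i j k _+_ refl f g n a b)) (ℤP.*-distribˡ-+ c _ _) })
          (sumOver-+ p _ _)

  shift-sumOver : ∀ i j k q (F : Term → Series) n a b →
                  shift i j k (λ x y z → sumOver q (λ r → F r x y z)) n a b ≡ sumOver q (λ r → shift i j k (F r) n a b)
  shift-sumOver i j k []      F n a b = shift-map i j k (λ _ → + 0) refl zeroSeries n a b
  shift-sumOver i j k (r ∷ q) F n a b =
    trans (shift-zip i j k _+_ refl (F r) _ n a b) (cong (λ x → shift i j k (F r) n a b + x) (shift-sumOver i j k q F n a b))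

  act-◃ : ∀ t q f n a b → act t (q ◃ f) n a b ≡ sumOver q (λ r → act (t ⋆ r) f n a b)
  act-◃ (c , i , j , k) q f n a b = begin
    c * shift i j k (q ◃ f) n a b
      ≡⟨ cong (c *_) (shift-sumOver i j k q (λ r → act r f) n a b) ⟩
    c * sumOver q (λ r → shift i j k (act r f) n a b)
      ≡⟨ sumOver-scale q c _ ⟩
    sumOver q (λ r → c * shift i j k (act r f) n a b)
      ≡⟨ sumOver-cong q (λ { (c′ , i′ , j′ , k′) →
           trans (cong (c *_) (trans (shift-map i j k (c′ *_) (ℤP.*-zeroʳ c′) (shift i′ j′ k′ f) n a b)
                                     (cong (c′ *_) (shift-shift i j k i′ j′ k′ f n a b))))
                 (sym (ℤP.*-assoc c c′ _)) }) ⟩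
    sumOver q (λ r → act ((c , i , j , k) ⋆ r) f n a b) ∎
    where open ≡-Reasoning

  ◃-·ₚ : ∀ p q f → p ·ₚ q ◃ f ≐ q ◃ p ◃ f
  ◃-·ₚ p []      f n a b = refl
  ◃-·ₚ p (r ∷ q) f n a b = begin
    sumOver (map (r ⋆_) p ++ p ·ₚ q) (λ t → act t f n a b)
      ≡⟨ sumOver-++ (map (r ⋆_) p) (p ·ₚ q) _ ⟩
    sumOver (map (r ⋆_) p) (λ t → act t f n a b) + (p ·ₚ q ◃ f) n a b
      ≡⟨ cong₂ _+_ (trans (sumOver-map (r ⋆_) p _) (sym (act-◃ r p f n a b))) (◃-·ₚ p q f n a b) ⟩
    act r (p ◃ f) n a b + (q ◃ p ◃ f) n a b ∎
    where open ≡-Reasoning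

  ⋆-comm : ∀ t r f → act (t ⋆ r) f ≐ act (r ⋆ t) f
  ⋆-comm (c , i , j , k) (c′ , i′ , j′ , k′) f n a b
    rewrite ℤP.*-comm c c′ | ℕP.+-comm i i′ | ℕP.+-comm j j′ | ℕP.+-comm k k′ = refl

  ◃-comm : ∀ p q f → p ◃ q ◃ f ≐ q ◃ p ◃ f
  ◃-comm p q f n a b = begin
    sumOver p (λ t → act t (q ◃ f) n a b)
      ≡⟨ sumOver-cong p (λ t → act-◃ t q f n a b) ⟩
    sumOver p (λ t → sumOver q (λ r → act (t ⋆ r) f n a b))
      ≡⟨ sumOver-swap p q _ ⟩
    sumOver q (λ r → sumOver p (λ t → act (t ⋆ r) f n a b))
      ≡⟨ sumOver-cong q (λ r → trans (sumOver-cong p (λ t → ⋆-comm t r f n a b)) (sym (act-◃ r p f n a b))) ⟩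
    sumOver q (λ r → act r (p ◃ f) n a b) ∎
    where open ≡-Reasoning

  ⊗-⟦⟧ : ∀ f p → f ⊗ ⟦ p ⟧ ≐ p ◃ f
  ⊗-⟦⟧ f p n a b = trans (⊗-congʳ f (⟦⟧-coeff p) n a b) (expand p)
    where
    expand : ∀ p → (f ⊗ (λ n a b → sumOver p (λ t → monomial t n a b))) n a b ≡ (p ◃ f) n a b
    expand []                  = ⊗-zeroʳ f n a b
    expand ((c , i , j , k) ∷ p) =
      trans (⊗-distribʳ f (mono c i j k) (λ n a b → sumOver p (λ t → monomial t n a b)) n a b) (cong₂ _+_ (⊗-mono f c i j k n a b) (expand p))

  one : Series
  one = mono (+ 1) 0 0 0

  ⟦⟧-◃-one : ∀ p → ⟦ p ⟧ ≐ p ◃ one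
  ⟦⟧-◃-one p n a b = trans (⟦⟧-coeff p n a b) (sumOver-cong p λ { (c , i , j , k) → sym (act-one c i j k) })
    where
    act-one : ∀ c i j k → c * shift i j k one n a b ≡ mono c i j k n a b
    act-one c i j k = begin
      c * shift i j k one n a b
        ≡⟨ cong (c *_) (shift-mono i j k (+ 1) 0 0 0 n a b) ⟩
      c * mono (+ 1) (i ℕ.+ 0) (j ℕ.+ 0) (k ℕ.+ 0) n a b
        ≡⟨ cong (c *_) (drop-zeros i j k) ⟩
      c * mono (+ 1) i j k n a b
        ≡⟨ cong (c *_) (trans (mono-ind (+ 1) i j k n a b) (ℤP.*-identityˡ _)) ⟩
      c * (ind i n * (ind j a * ind k b))
        ≡⟨ sym (mono-ind c i j k n a b) ⟩
      mono c i j k n a b ∎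
      where
      open ≡-Reasoning
      drop-zeros : ∀ i j k → mono (+ 1) (i ℕ.+ 0) (j ℕ.+ 0) (k ℕ.+ 0) n a b ≡ mono (+ 1) i j k n a b
      drop-zeros i j k rewrite ℕP.+-identityʳ i | ℕP.+-identityʳ j | ℕP.+-identityʳ k = refl

  ⟦⟧-⊗ : ∀ p q → ⟦ p ⟧ ⊗ ⟦ q ⟧ ≐ ⟦ p ·ₚ q ⟧
  ⟦⟧-⊗ p q = begin
    ⟦ p ⟧ ⊗ ⟦ q ⟧   ≈⟨ ⊗-⟦⟧ ⟦ p ⟧ q ⟩
    q ◃ ⟦ p ⟧       ≈⟨ ◃-cong q (⟦⟧-◃-one p) ⟩
    q ◃ p ◃ one     ≈⟨ ≐-sym (◃-·ₚ p q one) ⟩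
    p ·ₚ q ◃ one    ≈⟨ ≐-sym (⟦⟧-◃-one (p ·ₚ q)) ⟩
    ⟦ p ·ₚ q ⟧      ∎
    where open import Relation.Binary.Reasoning.Setoid ≐-setoid

module Insertion where

  open import Data.Nat as ℕ using (ℕ; zero; suc; pred; _≤_; _<_; _∸_; z≤n; s≤s)
  import Data.Nat.Properties as ℕP
  open import Data.Fin as Fin using (Fin; toℕ; fromℕ; inject₁)
  import Data.Fin.Properties as FinP
  open import Data.Vec as Vec using (Vec; []; _∷_; lookup; last; _∷ʳ_)
  import Data.Vec.Properties as VecP
  open import Data.Product using (Σ; _×_; _,_; proj₁; proj₂)
  open import Data.Sum using (inj₁; inj₂)
  open import Data.Empty using (⊥; ⊥-elim)
  open import Function using (_∘_)
  open import Relation.Nullary using (¬_; yes; no)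
  open import Relation.Binary using (tri<; tri≈; tri>)
  open import Relation.Binary.PropositionalEquality

  -- bump b x: the new value of an old entry x once the value b is inserted
  -- (entries below b stay, entries from b on move up by one); unbump b undoes it.
  bump : ℕ → ℕ → ℕ
  bump zero    x       = suc x
  bump (suc b) zero    = zero
  bump (suc b) (suc x) = suc (bump b x)

  unbump : ℕ → ℕ → ℕ
  unbump zero    x       = pred x
  unbump (suc b) zero    = zero
  unbump (suc b) (suc x) = suc (unbump b x)

  bump-below : ∀ {b x} → x < b → bump b x ≡ x
  bump-below {suc b} {zero}  _         = refl
  bump-below {suc b} {suc x} (s≤s x<b) = cong suc (bump-below x<b)

  bump-above : ∀ {b x} → b ≤ x → bump b x ≡ suc x
  bump-above {zero}              _         = refl
  bump-above {suc b} {suc x} (s≤s b≤x) = cong suc (bump-above b≤x)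

  bump-mono : ∀ b {x y} → x < y → bump b x < bump b y
  bump-mono zero    x<y                         = s≤s x<y
  bump-mono (suc b) {zero}  {suc y} _         = s≤s z≤n
  bump-mono (suc b) {suc x} {suc y} (s≤s x<y) = s≤s (bump-mono b x<y)

  bump-mono-≤ : ∀ b {x y} → x ≤ y → bump b x ≤ bump b y
  bump-mono-≤ zero    x≤y                       = s≤s x≤y
  bump-mono-≤ (suc b) {zero}          _         = z≤n
  bump-mono-≤ (suc b) {suc x} {suc y} (s≤s x≤y) = s≤s (bump-mono-≤ b x≤y)

  bump-reflects : ∀ b {x y} → bump b x < bump b y → x < y
  bump-reflects b {x} {y} lt with ℕP.<-cmp x y
  ... | tri< x<y _ _ = x<y
  ... | tri≈ _ refl _ = ⊥-elim (ℕP.<-irrefl refl lt)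
  ... | tri> _ _ y<x = ⊥-elim (ℕP.<-asym lt (bump-mono b y<x))

  bump-injective : ∀ b {x y} → bump b x ≡ bump b y → x ≡ y
  bump-injective b {x} {y} e with ℕP.<-cmp x y
  ... | tri< x<y _ _ = ⊥-elim (ℕP.<-irrefl e (bump-mono b x<y))
  ... | tri≈ _ x≡y _ = x≡y
  ... | tri> _ _ y<x = ⊥-elim (ℕP.<-irrefl (sym e) (bump-mono b y<x))

  bump-≢ : ∀ b x → bump b x ≢ b
  bump-≢ zero    x       ()
  bump-≢ (suc b) zero    ()
  bump-≢ (suc b) (suc x) e = bump-≢ b x (ℕP.suc-injective e)

  bump-unbump : ∀ b x → x ≢ b → bump b (unbump b x) ≡ x
  bump-unbump zero    zero    ne = ⊥-elim (ne refl)
  bump-unbump zero    (suc x) ne = refl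
  bump-unbump (suc b) zero    ne = refl
  bump-unbump (suc b) (suc x) ne = cong suc (bump-unbump b x (ne ∘ cong suc))

  bump-<-b : ∀ b x → bump b x < b → x < b
  bump-<-b b x lt with x ℕ.<? b
  ... | yes x<b = x<b
  ... | no  x≮b = ⊥-elim (ℕP.<-asym lt (subst (b <_) (sym (bump-above (ℕP.≮⇒≥ x≮b))) (s≤s (ℕP.≮⇒≥ x≮b))))

  b-<-bump : ∀ b x → b < bump b x → b ≤ x
  b-<-bump b x lt with x ℕ.<? b
  ... | yes x<b = ⊥-elim (ℕP.<-asym lt (subst (_< b) (sym (bump-below x<b)) x<b))
  ... | no  x≮b = ℕP.≮⇒≥ x≮b

  bump-bounds : ∀ b x → x ≤ bump b x × bump b x ≤ suc x
  bump-bounds b x with x ℕ.<? b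
  ... | yes x<b rewrite bump-below x<b = ℕP.≤-refl , ℕP.n≤1+n x
  ... | no  x≮b rewrite bump-above (ℕP.≮⇒≥ x≮b) = ℕP.n≤1+n x , ℕP.≤-refl

  data Position {n : ℕ} : Fin (suc n) → Set where
    inner : (i : Fin n) → Position (inject₁ i)
    final : Position (fromℕ n)

  position : ∀ {n} (j : Fin (suc n)) → Position j
  position {zero}  Fin.zero    = final
  position {suc n} Fin.zero    = inner Fin.zero
  position {suc n} (Fin.suc j) with position j
  ... | inner i = inner (Fin.suc i)
  ... | final   = final

  toℕ-inner : ∀ {n} (i : Fin n) → toℕ (inject₁ i) ≡ toℕ i
  toℕ-inner = FinP.toℕ-inject₁

  toℕ-final : ∀ n → toℕ (fromℕ n) ≡ n
  toℕ-final = FinP.toℕ-fromℕ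

  toℕ-≤ : ∀ {m} (i : Fin (suc m)) → toℕ i ≤ m
  toℕ-≤ = FinP.toℕ≤pred[n]

  is-final : ∀ {m} (i : Fin (suc m)) → toℕ i ≡ m → i ≡ fromℕ m
  is-final {m} i e = FinP.toℕ-injective (trans e (sym (toℕ-final m)))

  after-final : ∀ {n} (j : Fin (suc n)) → toℕ (fromℕ n) < toℕ j → ⊥
  after-final {n} j lt = ℕP.<-irrefl refl (ℕP.<-≤-trans lt (subst (toℕ j ≤_) (sym (toℕ-final n)) (toℕ-≤ j)))

  lookup-∷ʳ-inner : ∀ {n} (xs : Vec ℕ n) x (i : Fin n) → lookup (xs ∷ʳ x) (inject₁ i) ≡ lookup xs i
  lookup-∷ʳ-inner (y ∷ xs) x Fin.zero    = refl
  lookup-∷ʳ-inner (y ∷ xs) x (Fin.suc i) = lookup-∷ʳ-inner xs x i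

  lookup-∷ʳ-final : ∀ {n} (xs : Vec ℕ n) x → lookup (xs ∷ʳ x) (fromℕ n) ≡ x
  lookup-∷ʳ-final []       x = refl
  lookup-∷ʳ-final (y ∷ xs) x = lookup-∷ʳ-final xs x

  last-lookup : ∀ {n} (xs : Vec ℕ (suc n)) → last xs ≡ lookup xs (fromℕ n)
  last-lookup (x ∷ [])     = refl
  last-lookup (x ∷ y ∷ xs) = last-lookup (y ∷ xs)

  vec-ext : ∀ {n} (xs ys : Vec ℕ n) → (∀ i → lookup xs i ≡ lookup ys i) → xs ≡ ys
  vec-ext xs ys e = trans (sym (VecP.tabulate∘lookup xs)) (trans (VecP.tabulate-cong e) (VecP.tabulate∘lookup ys))

  -- σ ◂ b: append the value b to σ after bumping the old values. Every
  -- permutation of length n+1 arises this way from a unique σ (see decompose).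
  infixl 5 _◂_
  _◂_ : ∀ {n} → Vec ℕ n → ℕ → Vec ℕ (suc n)
  σ ◂ b = Vec.map (bump b) σ ∷ʳ b

  ◂-inner : ∀ {n} (σ : Vec ℕ n) b i → lookup (σ ◂ b) (inject₁ i) ≡ bump b (lookup σ i)
  ◂-inner σ b i = trans (lookup-∷ʳ-inner (Vec.map (bump b) σ) b i) (VecP.lookup-map i (bump b) σ)

  ◂-final : ∀ {n} (σ : Vec ℕ n) b → lookup (σ ◂ b) (fromℕ n) ≡ b
  ◂-final σ b = lookup-∷ʳ-final (Vec.map (bump b) σ) b

  last-◂ : ∀ {n} (σ : Vec ℕ n) b → last (σ ◂ b) ≡ b
  last-◂ σ b = VecP.last-∷ʳ b (Vec.map (bump b) σ)

  ◂-injective : ∀ {n} (σ τ : Vec ℕ n) b → σ ◂ b ≡ τ ◂ b → σ ≡ τ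
  ◂-injective σ τ b e = vec-ext σ τ λ i →
    bump-injective b (trans (sym (◂-inner σ b i)) (trans (cong (λ v → lookup v (inject₁ i)) e) (◂-inner τ b i)))

  decompose : ∀ {m} (π : Vec ℕ (suc (suc m))) → IsPerm (suc (suc m)) π → Σ (Vec ℕ (suc m)) λ σ → σ ◂ last π ≡ π
  decompose {m} π (_ , inj) with Vec.initLast π
  ... | τ , y , refl = Vec.map (unbump y) τ , cong (_∷ʳ y) (vec-ext _ _ unbumped)
    where
    distinct : ∀ i → lookup τ i ≢ y
    distinct i e = FinP.toℕ-inject₁-≢ i (sym (trans (cong toℕ (inj (inject₁ i) (fromℕ (suc m))
                     (trans (lookup-∷ʳ-inner τ y i) (trans e (sym (lookup-∷ʳ-final τ y))))))
                     (toℕ-final (suc m))))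
    unbumped : ∀ i → lookup (Vec.map (bump y) (Vec.map (unbump y) τ)) i ≡ lookup τ i
    unbumped i rewrite VecP.lookup-map i (bump y) (Vec.map (unbump y) τ)
                     | VecP.lookup-map i (unbump y) τ = bump-unbump y (lookup τ i) (distinct i)

  -- A permutation of {1,…,n} takes every value v with 1 ≤ v ≤ n (pigeonhole).
  value-occurs : ∀ {n} (π : Vec ℕ n) → IsPerm n π → ∀ v → 1 ≤ v → v ≤ n → Σ (Fin n) λ i → lookup π i ≡ v
  value-occurs {n} π (range , inj) v 1≤v v≤n with FinP.any? (λ i → lookup π i ℕ.≟ v)
  ... | yes found = found
  value-occurs {zero}  π (range , inj) v 1≤v v≤n | no missing = ⊥-elim (ℕP.<-irrefl refl (ℕP.<-≤-trans 1≤v v≤n))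
  value-occurs {suc m} π (range , inj) v 1≤v v≤n | no missing =
    ⊥-elim (ℕP.<-irrefl refl (FinP.injective⇒≤ {f = squeeze} squeeze-injective))
    where
    asFin : ∀ x → 1 ≤ x → x ≤ suc m → Fin (suc m)
    asFin (suc x) _ x<m = Fin.fromℕ< x<m
    asFin-injective : ∀ {x y} p q r s → asFin x p q ≡ asFin y r s → x ≡ y
    asFin-injective {suc x} {suc y} _ q _ s e = cong suc (FinP.fromℕ<-injective x y q s e)
    value : Fin (suc m) → Fin (suc m)
    value i = asFin (lookup π i) (proj₁ (range i)) (proj₂ (range i))
    target≢value : ∀ i → asFin v 1≤v v≤n ≢ value i
    target≢value i e = missing (i , sym (asFin-injective _ _ _ _ e))
    squeeze : Fin (suc m) → Fin m
    squeeze i = Fin.punchOut (target≢value i)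
    squeeze-injective : ∀ {i j} → squeeze i ≡ squeeze j → i ≡ j
    squeeze-injective {i} {j} e =
      inj i j (asFin-injective _ _ _ _ (FinP.punchOut-injective (target≢value i) (target≢value j) e))

  lookup-decreasing : ∀ n i → lookup (decreasing n) i ≡ n ∸ toℕ i
  lookup-decreasing n i = VecP.lookup∘tabulate (λ i → n ∸ toℕ i) i

  decreasing-no-ascent : ∀ n i → ¬ AscentAt (decreasing n) i
  decreasing-no-ascent n i (i′ , e , lt) rewrite lookup-decreasing n i | lookup-decreasing n i′ | e =
    ℕP.<⇒≱ lt (ℕP.∸-monoʳ-≤ n (ℕP.n≤1+n (toℕ i)))

  decreasing-final : ∀ m → lookup (decreasing (suc m)) (fromℕ m) ≡ 1
  decreasing-final m rewrite lookup-decreasing (suc m) (fromℕ m) | toℕ-final m = ℕP.m+n∸n≡m 1 m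

  decreasing-◂-1 : ∀ m → decreasing (suc m) ◂ 1 ≡ decreasing (suc (suc m))
  decreasing-◂-1 m = vec-ext _ _ entry
    where
    entry : ∀ j → lookup (decreasing (suc m) ◂ 1) j ≡ lookup (decreasing (suc (suc m))) j
    entry j with position j
    ... | inner i rewrite ◂-inner (decreasing (suc m)) 1 i | lookup-decreasing (suc m) i
                        | lookup-decreasing (suc (suc m)) (inject₁ i) | toℕ-inner i =
      trans (bump-above (ℕP.m<n⇒0<n∸m (s≤s (toℕ-≤ i)))) (sym (ℕP.+-∸-assoc 1 (ℕP.≤-trans (toℕ-≤ i) (ℕP.n≤1+n m))))
    ... | final rewrite ◂-final (decreasing (suc m)) 1 | lookup-decreasing (suc (suc m)) (fromℕ (suc m))
                      | toℕ-final m = sym (ℕP.m+n∸n≡m 1 m)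

  AscentsBelow : ∀ {n} → Vec ℕ n → ℕ → Set
  AscentsBelow {n} π s = ∀ i → AscentAt π i → lookup π i ≤ s

  HasS-bound : ∀ {n} {π : Vec ℕ n} {s} → HasS π s → AscentsBelow π s
  HasS-bound (inj₁ (refl , _))     i asc = ⊥-elim (decreasing-no-ascent _ i asc)
  HasS-bound (inj₂ (_ , _ , bound)) = bound

  HasS-intro : ∀ {n} (π : Vec ℕ n) {a} i → AscentAt π i → lookup π i ≡ a → AscentsBelow π a → HasS π a
  HasS-intro π i asc e bound = inj₂ ((λ { refl → decreasing-no-ascent _ i asc }) , (i , asc , e) , bound)

  HasS-unique : ∀ {n} {π : Vec ℕ n} {a a′} → HasS π a → HasS π a′ → a ≡ a′
  HasS-unique (inj₁ (_ , refl)) (inj₁ (_ , refl)) = refl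
  HasS-unique (inj₁ (e , _))    (inj₂ (ne , _))   = ⊥-elim (ne e)
  HasS-unique (inj₂ (ne , _))   (inj₁ (e , _))    = ⊥-elim (ne e)
  HasS-unique (inj₂ (_ , (i , asc , e) , bound)) (inj₂ (_ , (i′ , asc′ , e′) , bound′)) =
    ℕP.≤-antisym (subst (_≤ _) e (bound′ i asc)) (subst (_≤ _) e′ (bound i′ asc′))

  ascent-lift : ∀ {n} (σ : Vec ℕ n) b i → AscentAt σ i → AscentAt (σ ◂ b) (inject₁ i)
  ascent-lift σ b i (i′ , e , lt) = inject₁ i′ , trans (toℕ-inner i′) (trans e (cong suc (sym (toℕ-inner i)))) ,
    subst₂ _<_ (sym (◂-inner σ b i)) (sym (◂-inner σ b i′)) (bump-mono b lt)

  ascent-new : ∀ {m} (σ : Vec ℕ (suc m)) b → lookup σ (fromℕ m) < b → AscentAt (σ ◂ b) (inject₁ (fromℕ m))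
  ascent-new {m} σ b lt = fromℕ (suc m) , cong suc (sym (toℕ-inner (fromℕ m))) ,
    subst₂ _<_ (sym (trans (◂-inner σ b (fromℕ m)) (bump-below lt))) (sym (◂-final σ b)) lt

  ◂-ascents-below : ∀ {m} (σ : Vec ℕ (suc m)) b B →
    (∀ i → AscentAt σ i → bump b (lookup σ i) ≤ B) →
    (bump b (lookup σ (fromℕ m)) < b → bump b (lookup σ (fromℕ m)) ≤ B) →
    AscentsBelow (σ ◂ b) B
  ◂-ascents-below {m} σ b B old new j (j′ , e , lt) with position j | position j′
  ... | final   | _ = ⊥-elim (after-final j′ (subst (toℕ (fromℕ (suc m)) <_) (sym e) ℕP.≤-refl))
  ... | inner i | inner i′ rewrite ◂-inner σ b i | ◂-inner σ b i′ =
    old i (i′ , trans (sym (toℕ-inner i′)) (trans e (cong suc (toℕ-inner i))) , bump-reflects b lt)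
  ... | inner i | final rewrite ◂-inner σ b i | ◂-final σ b
    with is-final i (sym (ℕP.suc-injective (trans (sym (toℕ-final (suc m))) (trans e (cong suc (toℕ-inner i))))))
  ...   | refl = new lt

  ◂-s-bumped : ∀ {m} (σ : Vec ℕ (suc m)) {s b} → HasS σ s → 1 ≤ b → b ≤ last σ → s < last σ →
               HasS (σ ◂ b) (bump b s)
  ◂-s-bumped {m} σ {b = b} (inj₁ (refl , refl)) 1≤b b≤c _
    rewrite last-lookup σ | decreasing-final m | ℕP.≤-antisym b≤c 1≤b =
    inj₁ (decreasing-◂-1 m , refl)
  ◂-s-bumped {m} σ {s} {b} (inj₂ (_ , (i , asc , e) , bound)) 1≤b b≤c s<c rewrite last-lookup σ =
    HasS-intro (σ ◂ b) (inject₁ i) (ascent-lift σ b i asc) (trans (◂-inner σ b i) (cong (bump b) e))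
      (◂-ascents-below σ b (bump b s) (λ i asc → bump-mono-≤ b (bound i asc))
        (λ lt → ⊥-elim (ℕP.<-asym lt (subst (b <_) (sym (bump-above b≤c)) (s≤s b≤c)))))

  ◂-s-last : ∀ {m} (σ : Vec ℕ (suc m)) {s} → HasS σ s → s < last σ → HasS (σ ◂ suc (last σ)) (last σ)
  ◂-s-last {m} σ hs s<c rewrite last-lookup σ =
    HasS-intro (σ ◂ suc c) (inject₁ (fromℕ m)) (ascent-new σ (suc c) ℕP.≤-refl)
      (trans (◂-inner σ (suc c) (fromℕ m)) (bump-below ℕP.≤-refl))
      (◂-ascents-below σ (suc c) c
        (λ i asc → let σi<c = ℕP.≤-<-trans (HasS-bound hs i asc) s<c in
                   subst (_≤ c) (sym (bump-below (ℕP.<-trans σi<c (ℕP.n<1+n c)))) (ℕP.<⇒≤ σi<c))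
        (λ _ → subst (_≤ c) (sym (bump-below ℕP.≤-refl)) ℕP.≤-refl))
    where c = lookup σ (fromℕ m)

  ◂-s-succ : ∀ {m} (σ : Vec ℕ (suc m)) {s} → HasS σ s → last σ < s → HasS (σ ◂ suc (last σ)) (suc s)
  ◂-s-succ σ (inj₁ (_ , refl)) ()
  ◂-s-succ {m} σ {s} (inj₂ (_ , (i , asc , e) , bound)) c<s rewrite last-lookup σ =
    HasS-intro (σ ◂ suc c) (inject₁ i) (ascent-lift σ (suc c) i asc)
      (trans (◂-inner σ (suc c) i) (trans (cong (bump (suc c)) e) (bump-above c<s)))
      (◂-ascents-below σ (suc c) (suc s)
        (λ i asc → subst (bump (suc c) (lookup σ i) ≤_) (bump-above c<s) (bump-mono-≤ (suc c) (bound i asc)))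
        (λ _ → subst (_≤ suc s) (sym (bump-below ℕP.≤-refl)) (ℕP.≤-trans (ℕP.<⇒≤ c<s) (ℕP.n≤1+n s))))
    where c = lookup σ (fromℕ m)

  ◂-perm : ∀ {n} (σ : Vec ℕ n) b → IsPerm n σ → 1 ≤ b → b ≤ suc n → IsPerm (suc n) (σ ◂ b)
  ◂-perm {n} σ b (range , inj) 1≤b b≤ = range′ , inj′
    where
    range′ : ∀ j → 1 ≤ lookup (σ ◂ b) j × lookup (σ ◂ b) j ≤ suc n
    range′ j with position j
    ... | inner i rewrite ◂-inner σ b i =
      ℕP.≤-trans (proj₁ (range i)) (proj₁ (bump-bounds b _)) , ℕP.≤-trans (proj₂ (bump-bounds b _)) (s≤s (proj₂ (range i)))
    ... | final rewrite ◂-final σ b = 1≤b , b≤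
    inj′ : ∀ j j′ → lookup (σ ◂ b) j ≡ lookup (σ ◂ b) j′ → j ≡ j′
    inj′ j j′ e with position j | position j′
    ... | inner i | inner i′ rewrite ◂-inner σ b i | ◂-inner σ b i′ = cong inject₁ (inj i i′ (bump-injective b e))
    ... | inner i | final    rewrite ◂-inner σ b i | ◂-final σ b = ⊥-elim (bump-≢ b _ e)
    ... | final   | inner i′ rewrite ◂-inner σ b i′ | ◂-final σ b = ⊥-elim (bump-≢ b _ (sym e))
    ... | final   | final    = refl

  -- Appending b ≤ c+1 preserves avoiding 2-1-3: a new pattern would have to end
  -- at b with a 2 below b, hence at most c, giving the pattern 2-1-c in σ.
  ◂-avoids-213 : ∀ {m} (σ : Vec ℕ (suc m)) b → IsPerm (suc m) σ → Avoids2-1-3 σ →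
                 b ≤ suc (last σ) → Avoids2-1-3 (σ ◂ b)
  ◂-avoids-213 {m} σ b (_ , inj) avoid b≤c+1 i j k i<j j<k (p , q) with position i | position j | position k
  ... | final    | _        | _        = after-final j i<j
  ... | inner _  | final    | _        = after-final k j<k
  ... | inner i₀ | inner j₀ | inner k₀
    rewrite ◂-inner σ b i₀ | ◂-inner σ b j₀ | ◂-inner σ b k₀ | toℕ-inner i₀ | toℕ-inner j₀ | toℕ-inner k₀ =
    avoid i₀ j₀ k₀ i<j j<k (bump-reflects b p , bump-reflects b q)
  ... | inner i₀ | inner j₀ | final
    rewrite ◂-inner σ b i₀ | ◂-inner σ b j₀ | ◂-final σ b | toℕ-inner i₀ | toℕ-inner j₀ | last-lookup σ
    with ℕP.m≤n⇒m<n∨m≡n (ℕP.≤-pred (ℕP.<-≤-trans (bump-<-b b _ q) b≤c+1))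
  ...   | inj₂ σi≡c = ℕP.<-irrefl (trans (cong toℕ (inj i₀ (fromℕ m) σi≡c)) (toℕ-final m)) (ℕP.<-≤-trans i<j (toℕ-≤ j₀))
  ...   | inj₁ σi<c with toℕ j₀ ℕ.≟ m
  ...     | yes j₀-final = ℕP.<-asym (bump-reflects b p) (subst (lookup σ i₀ <_) (cong (lookup σ) (sym (is-final j₀ j₀-final))) σi<c)
  ...     | no  j₀-inner = avoid i₀ j₀ (fromℕ m) i<j (subst (toℕ j₀ <_) (sym (toℕ-final m)) (ℕP.≤∧≢⇒< (toℕ-≤ j₀) j₀-inner))
                             (bump-reflects b p , σi<c)

  -- Appending b preserves avoiding 34-21 when, in case b ≤ c, all ascent bottoms
  -- of σ are below c: a new pattern must use c, b as its 21 and an ascent above c as its 34.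
  ◂-avoids-3421 : ∀ {m} (σ : Vec ℕ (suc m)) b → Avoids34-21 σ →
                  (b ≤ last σ → ∀ i → AscentAt σ i → lookup σ i < last σ) → Avoids34-21 (σ ◂ b)
  ◂-avoids-3421 {m} σ b avoid below i i′ k k′ ei ek i+1<k (p , q , r) with position k′ | position k | position i | position i′
  ... | final    | final    | _        | _        = ℕP.1+n≢n (sym (ℕP.suc-injective (trans (sym (toℕ-final (suc m))) (trans ek (cong suc (toℕ-final (suc m)))))))
  ... | final    | inner _  | final    | _        = after-final k (ℕP.<-trans (ℕP.n<1+n _) i+1<k)
  ... | final    | inner _  | inner _  | final    = after-final k (subst (_< toℕ k) (sym ei) i+1<k)
  ... | inner _  | final    | _        | _        = after-final k′ (subst (toℕ (fromℕ (suc m)) <_) (sym ek) ℕP.≤-refl)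
  ... | inner _  | inner _  | final    | _        = after-final k (ℕP.<-trans (ℕP.n<1+n _) i+1<k)
  ... | inner _  | inner _  | inner _  | final    = after-final k (subst (_< toℕ k) (sym ei) i+1<k)
  ... | inner k₀′ | inner k₀ | inner i₀ | inner i₀′
    rewrite ◂-inner σ b k₀ | ◂-inner σ b k₀′ | ◂-inner σ b i₀ | ◂-inner σ b i₀′
          | toℕ-inner k₀ | toℕ-inner k₀′ | toℕ-inner i₀ | toℕ-inner i₀′ =
    avoid i₀ i₀′ k₀ k₀′ ei ek i+1<k (bump-reflects b p , bump-reflects b q , bump-reflects b r)
  ... | final    | inner k₀ | inner i₀ | inner i₀′
    rewrite ◂-inner σ b k₀ | ◂-inner σ b i₀ | ◂-inner σ b i₀′ | ◂-final σ b
    with is-final k₀ (sym (ℕP.suc-injective (trans (trans (sym (toℕ-final (suc m))) ek) (cong suc (toℕ-inner k₀)))))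
  ...   | refl = ℕP.<-asym (bump-reflects b q)
                   (subst (lookup σ i₀ <_) (last-lookup σ)
                     (below (subst (b ≤_) (sym (last-lookup σ)) (b-<-bump b _ p)) i₀
                       (i₀′ , trans (sym (toℕ-inner i₀′)) (trans ei (cong suc (toℕ-inner i₀))) , bump-reflects b r)))

  ◂-InC : ∀ {m} (σ : Vec ℕ (suc m)) {s} b → InC (suc m) σ → HasS σ s →
          1 ≤ b → b ≤ suc (last σ) → (b ≤ last σ → s < last σ) → InC (suc (suc m)) (σ ◂ b)
  ◂-InC {m} σ b (perm , avoid213 , avoid3421) hs 1≤b b≤c+1 s<c =
    ◂-perm σ b perm 1≤b (ℕP.≤-trans b≤c+1 (s≤s (subst (_≤ suc m) (sym (last-lookup σ)) (proj₂ (proj₁ perm (fromℕ m)))))) ,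
    ◂-avoids-213 σ b perm avoid213 b≤c+1 ,
    ◂-avoids-3421 σ b avoid3421 (λ b≤c i asc → ℕP.≤-<-trans (HasS-bound hs i asc) (s<c b≤c))

  ◂-range : ∀ {n} (σ : Vec ℕ n) b → InC (suc n) (σ ◂ b) → 1 ≤ b × b ≤ suc n
  ◂-range {n} σ b ((range , _) , _) = subst (λ x → 1 ≤ x × x ≤ suc n) (◂-final σ b) (range (fromℕ n))

  ◂-InC⁻¹ : ∀ {n} (σ : Vec ℕ n) b → InC (suc n) (σ ◂ b) → InC n σ
  ◂-InC⁻¹ {n} σ b π∈@((range , inj) , avoid213 , avoid3421) = (range′ , inj′) , avoid213′ , avoid3421′
    where
    1≤b×b≤ = ◂-range σ b π∈
    range′ : ∀ i → 1 ≤ lookup σ i × lookup σ i ≤ n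
    range′ i with range (inject₁ i) | lookup σ i ℕ.<? b
    ... | lo , _  | yes σi<b = subst (1 ≤_) (trans (◂-inner σ b i) (bump-below σi<b)) lo ,
                               ℕP.≤-pred (ℕP.<-≤-trans σi<b (proj₂ 1≤b×b≤))
    ... | _  , hi | no  σi≮b = ℕP.≤-trans (proj₁ 1≤b×b≤) (ℕP.≮⇒≥ σi≮b) ,
                               ℕP.≤-pred (subst (_≤ suc n) (trans (◂-inner σ b i) (bump-above (ℕP.≮⇒≥ σi≮b))) hi)
    inj′ : ∀ i j → lookup σ i ≡ lookup σ j → i ≡ j
    inj′ i j e = FinP.inject₁-injective (inj (inject₁ i) (inject₁ j)
                   (trans (◂-inner σ b i) (trans (cong (bump b) e) (sym (◂-inner σ b j)))))
    lift< : ∀ {i j} → lookup σ i < lookup σ j → lookup (σ ◂ b) (inject₁ i) < lookup (σ ◂ b) (inject₁ j)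
    lift< {i} {j} lt = subst₂ _<_ (sym (◂-inner σ b i)) (sym (◂-inner σ b j)) (bump-mono b lt)
    avoid213′ : Avoids2-1-3 σ
    avoid213′ i j k i<j j<k (p , q) = avoid213 (inject₁ i) (inject₁ j) (inject₁ k)
      (subst₂ _<_ (sym (toℕ-inner i)) (sym (toℕ-inner j)) i<j) (subst₂ _<_ (sym (toℕ-inner j)) (sym (toℕ-inner k)) j<k)
      (lift< p , lift< q)
    avoid3421′ : Avoids34-21 σ
    avoid3421′ i i′ k k′ ei ek i+1<k (p , q , r) = avoid3421 (inject₁ i) (inject₁ i′) (inject₁ k) (inject₁ k′)
      (trans (toℕ-inner i′) (trans ei (cong suc (sym (toℕ-inner i)))))
      (trans (toℕ-inner k′) (trans ek (cong suc (sym (toℕ-inner k)))))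
      (subst₂ (λ x y → suc x < y) (sym (toℕ-inner i)) (sym (toℕ-inner k)) i+1<k)
      (lift< p , lift< q , lift< r)

  -- Necessary conditions for σ ◂ b ∈ 𝒞 (c the last value of σ): b ≤ c+1, since otherwise
  -- c+1, c, b is a 2-1-3; and s < c when b ≤ c, since otherwise an ascent s, s′
  -- of σ followed by c, b is a 34-21.
  ◂-valid-≤ : ∀ {m} (σ : Vec ℕ (suc m)) b → InC (suc (suc m)) (σ ◂ b) → b ≤ suc (last σ)
  ◂-valid-≤ {m} σ b π∈ rewrite last-lookup σ with b ℕ.≤? suc (lookup σ (fromℕ m))
  ... | yes b≤c+1 = b≤c+1
  ... | no  b≰c+1 = ⊥-elim (proj₁ (proj₂ π∈) (inject₁ p) (inject₁ (fromℕ m)) (fromℕ (suc m))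
                      (subst₂ _<_ (sym (toℕ-inner p)) (sym (toℕ-inner (fromℕ m))) p<m)
                      (subst (_< toℕ (fromℕ (suc m))) (sym (toℕ-inner (fromℕ m))) (subst₂ _<_ (sym (toℕ-final m)) (sym (toℕ-final (suc m))) (ℕP.n<1+n m)))
                      (subst₂ _<_ (sym (trans (◂-inner σ b (fromℕ m)) (bump-below c<b)))
                                  (sym (trans (◂-inner σ b p) (trans (cong (bump b) σp≡c+1) (bump-below c+1<b)))) (ℕP.n<1+n c) ,
                       subst₂ _<_ (sym (trans (◂-inner σ b p) (trans (cong (bump b) σp≡c+1) (bump-below c+1<b))))
                                  (sym (◂-final σ b)) c+1<b))
    where
    c = lookup σ (fromℕ m)
    c+1<b : suc c < b
    c+1<b = ℕP.≰⇒> b≰c+1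
    c<b : c < b
    c<b = ℕP.<-trans (ℕP.n<1+n c) c+1<b
    c+1-occurs = value-occurs σ (proj₁ (◂-InC⁻¹ σ b π∈)) (suc c) (s≤s z≤n)
                   (ℕP.≤-pred (ℕP.<-≤-trans c+1<b (proj₂ (◂-range σ b π∈))))
    p = proj₁ c+1-occurs
    σp≡c+1 = proj₂ c+1-occurs
    p<m : toℕ p < toℕ (fromℕ m)
    p<m with ℕP.m≤n⇒m<n∨m≡n (toℕ-≤ p)
    ... | inj₁ p<m = subst (toℕ p <_) (sym (toℕ-final m)) p<m
    ... | inj₂ p≡m = ⊥-elim (ℕP.1+n≢n (trans (sym σp≡c+1) (cong (lookup σ) (is-final p p≡m))))

  ◂-valid-s : ∀ {m} (σ : Vec ℕ (suc m)) b {s} → InC (suc (suc m)) (σ ◂ b) → HasS σ s → b ≤ last σ → s < last σ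
  ◂-valid-s {m} σ b π∈ (inj₁ (refl , refl)) _ rewrite last-lookup σ = proj₁ (proj₁ (proj₁ (◂-InC⁻¹ σ b π∈)) (fromℕ m))
  ◂-valid-s {m} σ b π∈ (inj₂ (_ , (i , (i′ , ei , asc) , refl) , _)) b≤c rewrite last-lookup σ
    with ℕP.<-cmp (lookup σ i) (lookup σ (fromℕ m))
  ... | tri< s<c _ _ = s<c
  ... | tri≈ _ s≡c _ = ⊥-elim (after-final i′ (subst (λ x → toℕ x < toℕ i′) (inj i (fromℕ m) s≡c) (ℕP.≤-reflexive (sym ei))))
    where inj = proj₂ (proj₁ (◂-InC⁻¹ σ b π∈))
  ... | tri> _ _ c<s = ⊥-elim (proj₂ (proj₂ π∈) (inject₁ i) (inject₁ i′) (inject₁ (fromℕ m)) (fromℕ (suc m))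
          (trans (toℕ-inner i′) (trans ei (cong suc (sym (toℕ-inner i)))))
          (cong suc (sym (toℕ-inner (fromℕ m))))
          (subst₂ (λ x y → suc x < y) (sym (toℕ-inner i)) (sym (trans (toℕ-inner (fromℕ m)) (toℕ-final m))) i+1<m)
          (subst₂ _<_ (sym (◂-final σ b)) (sym (◂-inner σ b (fromℕ m))) (subst (b <_) (sym (bump-above b≤c)) (s≤s b≤c)) ,
           subst₂ _<_ (sym (◂-inner σ b (fromℕ m))) (sym (◂-inner σ b i)) (bump-mono b c<s) ,
           subst₂ _<_ (sym (◂-inner σ b i)) (sym (◂-inner σ b i′)) (bump-mono b asc)))
    where
    i+1<m : suc (toℕ i) < m
    i+1<m with ℕP.m≤n⇒m<n∨m≡n (subst (_≤ m) ei (toℕ-≤ i′))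
    ... | inj₁ lt = lt
    ... | inj₂ i′≡m = ⊥-elim (ℕP.<-asym c<s (subst (lookup σ i <_) (cong (lookup σ) (is-final i′ (trans ei i′≡m))) asc))

module Enumeration where

  open Insertion
  open import Data.Nat as ℕ using (ℕ; zero; suc; pred; _≤_; _<_; z≤n; s≤s)
  import Data.Nat.Properties as ℕP
  import Data.Fin as Fin
  open import Data.Vec using (Vec; []; _∷_; last)
  open import Data.List using (List; []; _∷_; _++_; map; length)
  import Data.List.Properties as ListP
  open import Data.List.Membership.Propositional using (_∈_)
  import Data.List.Membership.Propositional.Properties as ∈P
  open import Data.List.Relation.Unary.Any using (here)
  open import Data.List.Relation.Unary.Unique.Propositional using (Unique)
  import Data.List.Relation.Unary.Unique.Propositional.Properties as UniqueP
  open import Data.List.Relation.Unary.AllPairs using ([]; _∷_)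
  open import Data.List.Relation.Unary.All using ([])
  open import Data.Product using (Σ; _×_; _,_; proj₁; proj₂)
  open import Data.Sum using (_⊎_; inj₁; inj₂)
  open import Data.Empty using (⊥-elim)
  open import Relation.Nullary using (¬_; yes; no; recompute)
  open import Relation.Binary.PropositionalEquality

  Class : (m a b : ℕ) → Vec ℕ (suc m) → Set
  Class m a b π = InC (suc m) π × HasS π a × last π ≡ b

  -- Every π ∈ 𝒞 has last value s(π)+1 (diagonal) or a last value in 1 … s(π)-1 (below);
  -- these shapes govern the recursion.
  data Shape : ℕ → ℕ → Set where
    diagonal : ∀ a → Shape a (suc a)
    below    : ∀ {a b} → .(suc b < a) → Shape a (suc b)
    outside  : ∀ {a b} → b ≢ suc a → ¬ (1 ≤ b × b < a) → Shape a b

  shape : ∀ a b → Shape a b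
  shape a b with b ℕ.≟ suc a
  shape a .(suc a) | yes refl = diagonal a
  shape a zero     | no b≢ = outside b≢ λ { (() , _) }
  shape a (suc b)  | no b≢ with suc b ℕ.<? a
  ... | yes b<a = below b<a
  ... | no  b≮a = outside b≢ (λ p → b≮a (proj₂ p))

  shape-diagonal : ∀ a → shape a (suc a) ≡ diagonal a
  shape-diagonal a with shape a (suc a)
  ... | diagonal .a  = refl
  ... | below a+1<a  = ⊥-elim (ℕP.n≮n a (ℕP.<-trans (ℕP.n<1+n a) (recompute (suc a ℕ.<? a) a+1<a)))
  ... | outside ne _ = ⊥-elim (ne refl)

  shape-below : ∀ {a b} (b+1<a : suc b < a) → shape a (suc b) ≡ below b+1<a
  shape-below {a} {b} b+1<a with shape a (suc b)
  ... | diagonal .b  = ⊥-elim (ℕP.n≮n b (ℕP.<-trans (ℕP.n<1+n b) b+1<a))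
  ... | below _      = refl
  ... | outside _ not-below = ⊥-elim (not-below (s≤s z≤n , b+1<a))

  classList : (m a b : ℕ) → List (Vec ℕ (suc m))
  parents : (m : ℕ) → ∀ {a b} → Shape a b → List (Vec ℕ (suc m))

  classList zero    zero (suc zero) = (1 ∷ []) ∷ []
  classList zero    _    _          = []
  classList (suc m) a    b          = map (_◂ b) (parents m (shape a b))

  parents m (diagonal a)      = classList m a (suc a) ++ classList m (pred a) a
  parents m (below {a} {b} _) = classList m (pred a) b ++ classList m (pred a) a
  parents m (outside _ _)     = []

  count : ℕ → ℕ → ℕ → ℕ
  count m a b = length (classList m a b)

  member-shape : ∀ m {a b π} → π ∈ classList m a b → b ≡ suc a ⊎ (1 ≤ b × b < a)
  member-shape zero    {zero} {suc zero} (here refl) = inj₁ refl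
  member-shape (suc m) {a}    {b}        π∈ with ∈P.∈-map⁻ (_◂ b) π∈
  ... | σ , σ∈ , _ = of-shape (shape a b) σ∈
    where
    of-shape : ∀ {a b} (sh : Shape a b) {σ} → σ ∈ parents m sh → b ≡ suc a ⊎ (1 ≤ b × b < a)
    of-shape (diagonal a)       _ = inj₁ refl
    of-shape (below {a} {b} lt) _ = inj₂ (s≤s z≤n , recompute (suc b ℕ.<? a) lt)

  step-keep : ∀ {m s σ} → Class m s (suc s) σ → Class (suc m) s (suc s) (σ ◂ suc s)
  step-keep {s = s} {σ} (σC , hs , c≡s+1) =
    ◂-InC σ (suc s) σC hs (s≤s z≤n) (ℕP.≤-trans (ℕP.≤-reflexive (sym c≡s+1)) (ℕP.n≤1+n _)) (λ _ → s<c) ,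
    subst (HasS (σ ◂ suc s)) (bump-below (ℕP.n<1+n s)) (◂-s-bumped σ hs (s≤s z≤n) (ℕP.≤-reflexive (sym c≡s+1)) s<c) ,
    last-◂ σ (suc s)
    where s<c = subst (s <_) (sym c≡s+1) ℕP.≤-refl

  step-new : ∀ {m s σ} → Class m s (suc s) σ → Class (suc m) (suc s) (suc (suc s)) (σ ◂ suc (suc s))
  step-new {s = s} {σ} (σC , hs , c≡s+1) =
    ◂-InC σ (suc (suc s)) σC hs (s≤s z≤n) (s≤s (ℕP.≤-reflexive (sym c≡s+1)))
      (λ s+2≤c → ⊥-elim (ℕP.<-irrefl (sym c≡s+1) s+2≤c)) ,
    subst (λ x → HasS (σ ◂ suc x) x) c≡s+1 (◂-s-last σ hs (subst (s <_) (sym c≡s+1) ℕP.≤-refl)) ,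
    last-◂ σ (suc (suc s))

  step-succ : ∀ {m s c σ} → c < s → Class m s c σ → Class (suc m) (suc s) (suc c) (σ ◂ suc c)
  step-succ {c = c} {σ} c<s (σC , hs , refl) =
    ◂-InC σ (suc c) σC hs (s≤s z≤n) ℕP.≤-refl (λ c+1≤c → ⊥-elim (ℕP.<-irrefl refl c+1≤c)) ,
    ◂-s-succ σ hs c<s ,
    last-◂ σ (suc c)

  step-bumped : ∀ {m s b σ} → b < s → Class m s (suc s) σ → Class (suc m) (suc s) (suc b) (σ ◂ suc b)
  step-bumped {s = s} {b} {σ} b<s (σC , hs , c≡s+1) =
    ◂-InC σ (suc b) σC hs (s≤s z≤n) (ℕP.≤-trans b+1≤c (ℕP.n≤1+n _)) (λ _ → s<c) ,
    subst (HasS (σ ◂ suc b)) (bump-above b<s) (◂-s-bumped σ hs (s≤s z≤n) b+1≤c s<c) ,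
    last-◂ σ (suc b)
    where
    s<c = subst (s <_) (sym c≡s+1) ℕP.≤-refl
    b+1≤c = ℕP.≤-trans (ℕP.<⇒≤ (s≤s b<s)) (ℕP.≤-reflexive (sym c≡s+1))

  sound : ∀ m {a b π} → π ∈ classList m a b → Class m a b π
  parent-sound : ∀ m {a b} (sh : Shape a b) σ → σ ∈ parents m sh → Class (suc m) a b (σ ◂ b)

  sound zero    {zero} {suc zero} (here refl) = [1]∈𝒞 , inj₁ (refl , refl) , refl
    where
    [1]∈𝒞 : InC 1 (1 ∷ [])
    [1]∈𝒞 = ((λ { Fin.zero → s≤s z≤n , s≤s z≤n }) , (λ { Fin.zero Fin.zero _ → refl })) ,
            (λ { Fin.zero Fin.zero Fin.zero () }) , (λ { Fin.zero Fin.zero Fin.zero Fin.zero _ _ () })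
  sound (suc m) {a} {b} π∈ with ∈P.∈-map⁻ (_◂ b) π∈
  ... | σ , σ∈ , refl = parent-sound m (shape a b) σ σ∈

  parent-sound m (diagonal zero) σ σ∈ with ∈P.∈-++⁻ (classList m zero 1) σ∈
  ... | inj₁ σ∈₁ = step-keep (sound m σ∈₁)
  ... | inj₂ σ∈₂ with member-shape m σ∈₂
  ...   | inj₂ (() , _)
  parent-sound m (diagonal (suc a)) σ σ∈ with ∈P.∈-++⁻ (classList m (suc a) (suc (suc a))) σ∈
  ... | inj₁ σ∈₁ = step-keep (sound m σ∈₁)
  ... | inj₂ σ∈₂ = step-new (sound m σ∈₂)
  parent-sound m (below {zero} lt) σ σ∈ = ⊥-elim (ℕP.n≮0 (recompute (_ ℕ.<? 0) lt))
  parent-sound m (below {suc a} {b} lt) σ σ∈ with ∈P.∈-++⁻ (classList m a b) σ∈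
  ... | inj₁ σ∈₁ = step-succ (ℕP.≤-pred (recompute (suc b ℕ.<? suc a) lt)) (sound m σ∈₁)
  ... | inj₂ σ∈₂ = step-bumped (ℕP.≤-pred (recompute (suc b ℕ.<? suc a) lt)) (sound m σ∈₂)

  in-diagonal₁ : ∀ {m a σ} → σ ∈ classList m a (suc a) → σ ∈ parents m (shape a (suc a))
  in-diagonal₁ {m} {a} σ∈ rewrite shape-diagonal a = ∈P.∈-++⁺ˡ σ∈

  in-diagonal₂ : ∀ {m a σ} → σ ∈ classList m (pred a) a → σ ∈ parents m (shape a (suc a))
  in-diagonal₂ {m} {a} σ∈ rewrite shape-diagonal a = ∈P.∈-++⁺ʳ (classList m a (suc a)) σ∈

  in-below₁ : ∀ {m a b σ} → suc b < a → σ ∈ classList m (pred a) b → σ ∈ parents m (shape a (suc b))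
  in-below₁ b+1<a σ∈ rewrite shape-below b+1<a = ∈P.∈-++⁺ˡ σ∈

  in-below₂ : ∀ {m a b σ} → suc b < a → σ ∈ classList m (pred a) a → σ ∈ parents m (shape a (suc b))
  in-below₂ {m} {a} {b} b+1<a σ∈ rewrite shape-below b+1<a = ∈P.∈-++⁺ʳ (classList m (pred a) b) σ∈

  locate : ∀ {m s c b σ} → σ ∈ classList m s c → 1 ≤ b → b ≤ suc c → (b ≤ c → s < c) →
           Σ ℕ λ a → σ ∈ parents m (shape a b)
  locate {m} {s} {c} {b} σ∈ 1≤b b≤c+1 s<c with member-shape m σ∈ | ℕP.m≤n⇒m<n∨m≡n b≤c+1
  ... | inj₁ refl        | inj₂ refl = suc s , in-diagonal₂ σ∈
  ... | inj₂ (_ , c<s)   | inj₂ refl = suc s , in-below₁ (s≤s c<s) σ∈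
  ... | inj₂ (_ , c<s)   | inj₁ b<c+1 = ⊥-elim (ℕP.<-asym c<s (s<c (ℕP.≤-pred b<c+1)))
  ... | inj₁ refl        | inj₁ b<c+1 with ℕP.m≤n⇒m<n∨m≡n (ℕP.≤-pred b<c+1)
  ...   | inj₂ refl = s , in-diagonal₁ σ∈
  locate {s = s} {b = suc b} σ∈ 1≤b b≤c+1 s<c | inj₁ refl | inj₁ _ | inj₁ b+1<s+1 = suc s , in-below₂ b+1<s+1 σ∈

  complete′ : ∀ m π → InC (suc m) π → Σ ℕ λ a → π ∈ classList m a (last π)
  complete′ zero (x ∷ []) πC with ℕP.≤-antisym (proj₂ (proj₁ (proj₁ πC) Fin.zero)) (proj₁ (proj₁ (proj₁ πC) Fin.zero))
  ... | refl = 0 , here refl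
  complete′ (suc m) π πC with decompose π (proj₁ πC)
  ... | σ , σ◂b≡π = a , subst (λ v → v ∈ classList (suc m) a (last π)) σ◂b≡π (∈P.∈-map⁺ (_◂ last π) σ∈)
    where
    πC′ = subst (InC (suc (suc m))) (sym σ◂b≡π) πC
    listed = complete′ m σ (◂-InC⁻¹ σ (last π) πC′)
    hs = proj₁ (proj₂ (sound m (proj₂ listed)))
    located = locate (proj₂ listed) (proj₁ (◂-range σ (last π) πC′)) (◂-valid-≤ σ (last π) πC′)
                (◂-valid-s σ (last π) πC′ hs)
    a = proj₁ located
    σ∈ = proj₂ located

  -- Completeness: s(π) pins down the class in which complete′ finds π.
  complete : ∀ m {a b π} → Class m a b π → π ∈ classList m a b
  complete m {π = π} (πC , hs , refl) with complete′ m π πC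
  ... | a′ , π∈ = subst (λ x → π ∈ classList m x (last π)) (HasS-unique (proj₁ (proj₂ (sound m π∈))) hs) π∈

  -- No repetitions: ◂ b is injective and the two halves of a parent list differ in last value.
  unique : ∀ m a b → Unique (classList m a b)
  unique zero    zero    zero          = []
  unique zero    zero    (suc zero)    = [] ∷ []
  unique zero    zero    (suc (suc b)) = []
  unique zero    (suc a) b             = []
  unique (suc m) a       b             = UniqueP.map⁺ (◂-injective _ _ b) (parents-unique (shape a b))
    where
    last-of : ∀ {a b σ} → σ ∈ classList m a b → last σ ≡ b
    last-of σ∈ = proj₂ (proj₂ (sound m σ∈))
    parents-unique : ∀ {a b} (sh : Shape a b) → Unique (parents m sh)
    parents-unique (diagonal a) = UniqueP.++⁺ (unique m a (suc a)) (unique m (pred a) a)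
      λ (σ∈₁ , σ∈₂) → ℕP.1+n≢n (trans (sym (last-of σ∈₁)) (last-of σ∈₂))
    parents-unique (below {a} {b} lt) = UniqueP.++⁺ (unique m (pred a) b) (unique m (pred a) a)
      λ (σ∈₁ , σ∈₂) → ℕP.<-irrefl (trans (sym (last-of σ∈₁)) (last-of σ∈₂))
                        (ℕP.<-trans (ℕP.n<1+n b) (recompute (suc b ℕ.<? a) lt))
    parents-unique (outside _ _) = []

  count-card : ∀ m a b → HasCard (Class m a b) (count m a b)
  count-card m a b = classList m a b , unique m a b , (λ π → sound m , complete m) , refl

  count-diagonal : ∀ m a → count (suc m) a (suc a) ≡ count m a (suc a) ℕ.+ count m (pred a) a
  count-diagonal m a rewrite ListP.length-map (_◂ suc a) (parents m (shape a (suc a))) | shape-diagonal a =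
    ListP.length-++ (classList m a (suc a))

  count-below : ∀ m {a b} → suc b < a → count (suc m) a (suc b) ≡ count m (pred a) b ℕ.+ count m (pred a) a
  count-below m {a} {b} b+1<a rewrite ListP.length-map (_◂ suc b) (parents m (shape a (suc b))) | shape-below b+1<a =
    ListP.length-++ (classList m (pred a) b)

  count-outside : ∀ m {a b} → b ≢ suc a → ¬ (1 ≤ b × b < a) → count m a b ≡ 0
  count-outside zero    {zero}  {zero}          _  _ = refl
  count-outside zero    {zero}  {suc zero}      ne _ = ⊥-elim (ne refl)
  count-outside zero    {zero}  {suc (suc b)}   _  _ = refl
  count-outside zero    {suc a}                 _  _ = refl
  count-outside (suc m) {a}     {b}             ne no-below with shape a b
  ... | diagonal _    = ⊥-elim (ne refl)
  ... | below lt      = ⊥-elim (no-below (s≤s z≤n , recompute (_ ℕ.<? a) lt))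
  ... | outside _ _   = refl

module FunctionalEquations where

  open PowerSeries
  open Enumeration
  open import Data.Bool using (Bool; true; false; T; _∧_)
  open import Data.Nat as ℕ using (ℕ; zero; suc; pred; _≡ᵇ_; _<ᵇ_; _∸_; _<_; _≤_; z≤n; s≤s)
  import Data.Nat.Properties as ℕP
  open import Data.Integer using (ℤ; +_; -_; _+_; _*_)
  open import Data.Integer.Tactic.RingSolver using (solve-∀)
  open import Data.List using ([]; _∷_)
  import Data.Integer.Properties as ℤP
  open import Data.Product using (_×_; _,_)
  open import Data.Unit using (tt)
  open import Data.Empty using (⊥-elim)
  open import Relation.Nullary using (¬_)
  open import Relation.Binary.PropositionalEquality

  K : Series
  K zero    a b = + 0
  K (suc m) a b = + count m a b

  diag : ℕ → ℕ → ℤ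
  diag zero    a = + 0
  diag (suc m) a = + count m a (suc a)

  diag-pascal : ∀ n a → diag (suc n) (suc a) ≡ diag n (suc a) + diag n a
  diag-pascal zero    a = refl
  diag-pascal (suc m) a = cong +_ (count-diagonal m (suc a))

  diag-base : ∀ n → diag (suc n) 0 ≡ diag n 0 + ind 0 n
  diag-base zero    = refl
  diag-base (suc m) = cong +_ (trans (count-diagonal m 0) (cong (count m 0 1 ℕ.+_) (count-outside m (λ ()) (λ { (() , _) }))))

  when : Bool → ℤ → ℤ
  when true  x = x
  when false _ = + 0

  when-zero : ∀ g → when g (+ 0) ≡ + 0
  when-zero true  = refl
  when-zero false = refl

  when-+ : ∀ g x y → when g (x + y) ≡ when g x + when g y
  when-+ true  x y = refl
  when-+ false x y = refl

  inside : ℕ → ℕ → Bool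
  inside a b = (0 <ᵇ b) ∧ (b <ᵇ a)

  <ᵇ-true : ∀ {m n} → (m <ᵇ n) ≡ true → m < n
  <ᵇ-true {m} {n} e = ℕP.<ᵇ⇒< m n (subst T (sym e) tt)

  ≡ᵇ-true : ∀ {m n} → (m ≡ᵇ n) ≡ true → m ≡ n
  ≡ᵇ-true {m} {n} e = ℕP.≡ᵇ⇒≡ m n (subst T (sym e) tt)

  point : ℕ → ℕ → ℕ → Series
  point i j k n a b = ind i n * (ind j a * ind k b)

  point-mono : ∀ i j k → point i j k ≐ mono (+ 1) i j k
  point-mono i j k n a b = sym (trans (mono-ind (+ 1) i j k n a b) (ℤP.*-identityˡ _))

  X Y : Series
  X n a b = when (b ≡ᵇ suc a) (diag n a)
  Y n a b = when (inside a b) (K n a b)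

  ≡ᵇ-false : ∀ {m n} → (m ≡ᵇ n) ≡ false → m ≢ n
  ≡ᵇ-false {m} e m≡n = subst T e (ℕP.≡⇒≡ᵇ m _ m≡n)

  inside-false : ∀ {a b} → inside a b ≡ false → ¬ (1 ≤ b × b < a)
  inside-false {b = suc b} e (_ , b<a) = subst T e (ℕP.<⇒<ᵇ b<a)

  -- Off the diagonal K is Y, by the support of the counts.
  K-split-suc : ∀ m a b g h → g ≡ (b ≡ᵇ suc a) → h ≡ inside a b →
                + count m a b ≡ when g (diag (suc m) a) + when h (+ count m a b)
  K-split-suc m a b true h g≡ h≡ with ≡ᵇ-true {b} {suc a} (sym g≡)
  K-split-suc m a .(suc a) true false g≡ h≡ | refl = sym (ℤP.+-identityʳ _)
  K-split-suc m a .(suc a) true true  g≡ h≡ | refl = ⊥-elim (ℕP.n≮n a (ℕP.<-trans (ℕP.n<1+n a) (<ᵇ-true (sym h≡))))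
  K-split-suc m a b false true  g≡ h≡ = refl
  K-split-suc m a b false false g≡ h≡ = cong +_ (count-outside m (≡ᵇ-false (sym g≡)) (inside-false (sym h≡)))

  K-split : ∀ n a b → K n a b ≡ X n a b + Y n a b
  K-split zero    a b = sym (cong₂ _+_ (when-zero (b ≡ᵇ suc a)) (when-zero (inside a b)))
  K-split (suc m) a b = K-split-suc m a b (b ≡ᵇ suc a) (inside a b) refl refl

  -- (1 - t - tuv) X = tv:  X = t X + tuv X + tv, by Pascal's rule on the diagonal.
  X-rec : ∀ n a b → X n a b ≡ shift 1 0 0 X n a b + shift 1 1 1 X n a b + point 1 0 1 n a b
  X-rec zero    a       b             = when-zero (b ≡ᵇ suc a)
  X-rec (suc n) zero    zero          rewrite ℤP.*-zeroʳ (ind 0 n) = refl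
  X-rec (suc n) zero    (suc zero)    rewrite ℤP.*-identityʳ (ind 0 n) | ℤP.+-identityʳ (diag n 0) = diag-base n
  X-rec (suc n) zero    (suc (suc b)) rewrite ℤP.*-zeroʳ (ind 0 n) = refl
  X-rec (suc n) (suc a) zero          rewrite ℤP.*-zeroʳ (ind 0 n) = refl
  X-rec (suc n) (suc a) (suc b)
    rewrite ℤP.*-zeroʳ (ind 0 n) | ℤP.+-identityʳ (when (b ≡ᵇ suc a) (diag n (suc a)) + when (b ≡ᵇ suc a) (diag n a)) =
    trans (cong (when (b ≡ᵇ suc a)) (diag-pascal n a)) (when-+ (b ≡ᵇ suc a) _ _)

  -- Below the diagonal, appending to a diagonal prefix contributes diag:
  -- (1 - tuv) Y = W, where W = [1 ≤ b < a] diag (n-1) (a-1).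
  W : Series
  W n a b = when (inside a b) (diag (pred n) (pred a))

  Y-rec : ∀ n a b → Y n a b ≡ shift 1 1 1 Y n a b + W n a b
  Y-rec zero          a             b             =
    trans (when-zero (inside a b)) (sym (trans (ℤP.+-identityˡ _) (when-zero (inside a b))))
  Y-rec (suc n)       zero          zero          = refl
  Y-rec (suc n)       zero          (suc b)       = refl
  Y-rec (suc n)       (suc a)       zero          = refl
  Y-rec (suc n)       (suc zero)    (suc zero)    = refl
  Y-rec (suc zero)    (suc (suc a)) (suc zero)    = refl
  Y-rec (suc (suc m)) (suc (suc a)) (suc zero)    =
    cong +_ (trans (count-below m (s≤s (s≤s z≤n))) (cong (ℕ._+ count m (suc a) (suc (suc a))) (count-outside m (λ ()) (λ { (() , _) }))))
  Y-rec (suc n)       (suc a)       (suc (suc b)) = far-below n (suc b <ᵇ a) refl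
    where
    far-below : ∀ n g → g ≡ (suc b <ᵇ a) → when g (K (suc n) (suc a) (suc (suc b))) ≡ when g (K n a (suc b)) + when g (diag n a)
    far-below n       false _  = refl
    far-below zero    true  _  = refl
    far-below (suc m) true  g≡ = cong +_ (count-below m (s≤s (<ᵇ-true (sym g≡))))

  V : Series
  V n a b = when ((b ≡ᵇ 1) ∧ (1 <ᵇ a)) (diag (n ∸ 2) (a ∸ 2))

  W-rec : ∀ n a b → W n a b ≡ shift 1 0 0 W n a b + shift 1 1 1 W n a b + V n a b
  W-rec zero          a             b             =
    trans (when-zero (inside a b)) (sym (trans (ℤP.+-identityˡ _) (when-zero ((b ≡ᵇ 1) ∧ (1 <ᵇ a)))))
  W-rec (suc n)       zero          zero          = refl
  W-rec (suc n)       zero          (suc zero)    = refl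
  W-rec (suc n)       zero          (suc (suc b)) = refl
  W-rec (suc n)       (suc a)       zero          = refl
  W-rec (suc n)       (suc zero)    (suc zero)    = refl
  W-rec (suc zero)    (suc (suc a)) (suc zero)    = refl
  W-rec (suc (suc n)) (suc (suc a)) (suc zero)    rewrite ℤP.+-identityʳ (diag n (suc a)) = diag-pascal n a
  W-rec (suc n)       (suc a)       (suc (suc b)) = far-below n a (suc b <ᵇ a) refl
    where
    far-below : ∀ n a g → g ≡ (suc b <ᵇ a) →
                when g (diag n a) ≡ when g (diag (pred n) a) + when g (diag (pred n) (pred a)) + + 0
    far-below n       a       false _  = refl
    far-below n       zero    true  g≡ = ⊥-elim (ℕP.n≮0 (<ᵇ-true {suc b} {0} (sym g≡)))
    far-below zero    (suc a) true  _  = refl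
    far-below (suc n) (suc a) true  _  rewrite ℤP.+-identityʳ (diag n (suc a) + diag n a) = diag-pascal n a

  -- (1 - t - tu) V = t³u²v, by Pascal's rule once more.
  V-rec : ∀ n a b → V n a b ≡ shift 1 0 0 V n a b + shift 1 1 0 V n a b + point 3 2 1 n a b
  V-rec zero                a             b             = when-zero ((b ≡ᵇ 1) ∧ (1 <ᵇ a))
  V-rec (suc n)             zero          zero          rewrite ℤP.*-zeroʳ (ind 2 n) = refl
  V-rec (suc n)             (suc a)       zero          rewrite ℤP.*-zeroʳ (ind 1 a) | ℤP.*-zeroʳ (ind 2 n) = refl
  V-rec (suc n)             zero          (suc (suc b)) rewrite ℤP.*-zeroʳ (ind 2 n) = refl
  V-rec (suc n)             (suc a)       (suc (suc b)) rewrite ℤP.*-zeroʳ (ind 1 a) | ℤP.*-zeroʳ (ind 2 n) = refl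
  V-rec (suc n)             zero          (suc zero)    rewrite ℤP.*-zeroʳ (ind 2 n) = refl
  V-rec (suc n)             (suc zero)    (suc zero)    rewrite ℤP.*-zeroʳ (ind 2 n) = refl
  V-rec (suc zero)          (suc (suc a)) (suc zero)    rewrite when-zero (0 <ᵇ a) = refl
  V-rec (suc (suc zero))    (suc (suc a)) (suc zero)    rewrite when-zero (0 <ᵇ a) = refl
  V-rec (suc (suc (suc n))) (suc (suc zero)) (suc zero) rewrite ℤP.*-identityʳ (ind 0 n) | ℤP.+-identityʳ (diag n 0) = diag-base n
  V-rec (suc (suc (suc n))) (suc (suc (suc a))) (suc zero)
    rewrite ℤP.*-zeroʳ (ind 0 n) | ℤP.+-identityʳ (diag n (suc a) + diag n a) = diag-pascal n a

  P Q R N : Poly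
  P = (+ 1 , 0 , 0 , 0) ∷ (- + 1 , 1 , 0 , 0) ∷ (- + 1 , 1 , 1 , 0) ∷ []
  Q = (+ 1 , 0 , 0 , 0) ∷ (- + 1 , 1 , 0 , 0) ∷ (- + 1 , 1 , 1 , 1) ∷ []
  R = (+ 1 , 0 , 0 , 0) ∷ (- + 1 , 1 , 1 , 1) ∷ []
  N = (+ 1 , 0 , 0 , 0) ∷ (- + 1 , 1 , 0 , 0) ∷ (- + 1 , 1 , 1 , 0) ∷ (- + 1 , 1 , 1 , 1) ∷
      (+ 1 , 2 , 2 , 0) ∷ (+ 1 , 2 , 1 , 1) ∷ (+ 1 , 2 , 2 , 1) ∷ []

  solve-rec₁ : ∀ {f g} i j k → (∀ n a b → f n a b ≡ shift i j k f n a b + g n a b) →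
               ((+ 1 , 0 , 0 , 0) ∷ (- + 1 , i , j , k) ∷ []) ◃ f ≐ g
  solve-rec₁ {f} {g} i j k rec n a b =
    trans (cong (λ x → + 1 * x + _) (rec n a b)) (cancel (shift i j k f n a b) (g n a b))
    where cancel : ∀ s x → + 1 * (s + x) + (- + 1 * s + + 0) ≡ x
          cancel = solve-∀

  solve-rec₂ : ∀ {f g} i j k i′ j′ k′ → (∀ n a b → f n a b ≡ shift i j k f n a b + shift i′ j′ k′ f n a b + g n a b) →
               ((+ 1 , 0 , 0 , 0) ∷ (- + 1 , i , j , k) ∷ (- + 1 , i′ , j′ , k′) ∷ []) ◃ f ≐ g
  solve-rec₂ {f} {g} i j k i′ j′ k′ rec n a b =
    trans (cong (λ x → + 1 * x + _) (rec n a b)) (cancel (shift i j k f n a b) (shift i′ j′ k′ f n a b) (g n a b))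
    where cancel : ∀ s s′ x → + 1 * (s + s′ + x) + (- + 1 * s + (- + 1 * s′ + + 0)) ≡ x
          cancel = solve-∀

  Q◃X : Q ◃ X ≐ point 1 0 1
  Q◃X = solve-rec₂ 1 0 0 1 1 1 X-rec

  R◃Y : R ◃ Y ≐ W
  R◃Y = solve-rec₁ 1 1 1 Y-rec

  Q◃W : Q ◃ W ≐ V
  Q◃W = solve-rec₂ 1 0 0 1 1 1 W-rec

  P◃V : P ◃ V ≐ point 3 2 1
  P◃V = solve-rec₂ 1 0 0 1 1 0 V-rec

module Assembly where
  open PowerSeries
  open FunctionalEquations
  open import Data.Nat using (ℕ)
  open import Data.Integer using (ℤ; +_; -_; _+_; _*_)
  open import Data.Integer.Tactic.RingSolver using (solve-∀)
  open import Relation.Binary.PropositionalEquality using (_≡_; cong; cong₂; trans)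
  open import Relation.Binary.Reasoning.Setoid ≐-setoid

  ⊕-cong : ∀ {f f′ g g′} → f ≐ f′ → g ≐ g′ → f ⊕ g ≐ f′ ⊕ g′
  ⊕-cong e e′ n a b = cong₂ _+_ (e n a b) (e′ n a b)

  tv : Series
  tv = mono (+ 1) 1 0 1

  diagonal-part : R ◃ Q ◃ P ◃ X ≐ R ◃ P ◃ tv
  diagonal-part = begin
    R ◃ Q ◃ P ◃ X          ≈⟨ ◃-cong R (◃-comm Q P X) ⟩
    R ◃ P ◃ Q ◃ X          ≈⟨ ◃-cong R (◃-cong P Q◃X) ⟩
    R ◃ P ◃ point 1 0 1    ≈⟨ ◃-cong R (◃-cong P (point-mono 1 0 1)) ⟩
    R ◃ P ◃ tv             ∎

  below-part : R ◃ Q ◃ P ◃ Y ≐ shift 2 2 0 tv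
  below-part = begin
    R ◃ Q ◃ P ◃ Y          ≈⟨ ◃-cong R (◃-comm Q P Y) ⟩
    R ◃ P ◃ Q ◃ Y          ≈⟨ ◃-comm R P (Q ◃ Y) ⟩
    P ◃ R ◃ Q ◃ Y          ≈⟨ ◃-cong P (◃-comm R Q Y) ⟩
    P ◃ Q ◃ R ◃ Y          ≈⟨ ◃-cong P (◃-cong Q R◃Y) ⟩
    P ◃ Q ◃ W              ≈⟨ ◃-cong P Q◃W ⟩
    P ◃ V                  ≈⟨ P◃V ⟩
    point 3 2 1            ≈⟨ point-mono 3 2 1 ⟩
    mono (+ 1) 3 2 1       ≈⟨ ≐-sym (shift-mono 2 2 0 (+ 1) 1 0 1) ⟩
    shift 2 2 0 tv         ∎

  numerator-identity : R ◃ P ◃ tv ⊕ shift 2 2 0 tv ≐ N ◃ tv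
  numerator-identity n a b =
    trans (cong (_+ shift 2 2 0 tv n a b) (sumOver-cong R λ r → act-◃ r P tv n a b))
          (collect (s 0 0 0) (s 1 0 0) (s 1 1 0) (s 1 1 1) (s 2 1 1) (s 2 2 1) (s 2 2 0))
    where
    s : ℕ → ℕ → ℕ → ℤ
    s i j k = shift i j k tv n a b
    collect : ∀ s000 s100 s110 s111 s211 s221 s220 →
      (+ 1 * s000 + (- + 1 * s100 + (- + 1 * s110 + + 0)) +
       ((- + 1 * s111 + (+ 1 * s211 + (+ 1 * s221 + + 0))) + + 0)) + s220
      ≡ + 1 * s000 + (- + 1 * s100 + (- + 1 * s110 + (- + 1 * s111 +
        (+ 1 * s220 + (+ 1 * s211 + (+ 1 * s221 + + 0))))))
    collect = solve-∀

  K-equation : K ⊗ denominator ≐ numerator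
  K-equation = begin
    K ⊗ denominator                          ≈⟨ ⊗-congʳ K denominator-expanded ⟩
    K ⊗ ⟦ P ·ₚ Q ·ₚ R ⟧                      ≈⟨ ⊗-⟦⟧ K (P ·ₚ Q ·ₚ R) ⟩
    P ·ₚ Q ·ₚ R ◃ K                          ≈⟨ ◃-·ₚ (P ·ₚ Q) R K ⟩
    R ◃ P ·ₚ Q ◃ K                           ≈⟨ ◃-cong R (◃-·ₚ P Q K) ⟩
    R ◃ Q ◃ P ◃ K                            ≈⟨ ◃-cong R (◃-cong Q (◃-cong P K-split)) ⟩
    R ◃ Q ◃ P ◃ (X ⊕ Y)                      ≈⟨ ◃-cong R (◃-cong Q (◃-⊕ P X Y)) ⟩
    R ◃ Q ◃ (P ◃ X ⊕ P ◃ Y)                  ≈⟨ ◃-cong R (◃-⊕ Q (P ◃ X) (P ◃ Y)) ⟩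
    R ◃ (Q ◃ P ◃ X ⊕ Q ◃ P ◃ Y)              ≈⟨ ◃-⊕ R (Q ◃ P ◃ X) (Q ◃ P ◃ Y) ⟩
    R ◃ Q ◃ P ◃ X ⊕ R ◃ Q ◃ P ◃ Y            ≈⟨ ⊕-cong diagonal-part below-part ⟩
    R ◃ P ◃ tv ⊕ shift 2 2 0 tv              ≈⟨ numerator-identity ⟩
    N ◃ tv                                   ≈⟨ ≐-sym (⊗-⟦⟧ tv N) ⟩
    numerator                                ∎
    where
    denominator-expanded : denominator ≐ ⟦ P ·ₚ Q ·ₚ R ⟧
    denominator-expanded = begin
      ⟦ P ⟧ ⊗ ⟦ Q ⟧ ⊗ ⟦ R ⟧   ≈⟨ ⊗-congˡ ⟦ R ⟧ (⟦⟧-⊗ P Q) ⟩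
      ⟦ P ·ₚ Q ⟧ ⊗ ⟦ R ⟧      ≈⟨ ⟦⟧-⊗ (P ·ₚ Q) R ⟩
      ⟦ P ·ₚ Q ·ₚ R ⟧         ∎

open import Data.Product using (Σ; _×_; _,_)
open import Relation.Binary.PropositionalEquality using (_≡_; refl)
open Enumeration using (count; count-card)
open FunctionalEquations using (K)
open Assembly using (K-equation)

proposition3p6 : Σ Series λ K → IsK K × (∀ n a b → (K ⊗ denominator) n a b ≡ numerator n a b)
proposition3p6 = K , ((λ a b → refl) , (λ m a b → count m a b , refl , count-card m a b)) , K-equation
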